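{- Let $G$ be a graph. Then there exists a sign $\sigma$ for $G$ such that the signed adjacency matrix $A(G^{\sigma})$ has full rank (i.e. rank equal to $|V(G)|$) if and only if $G$ has full perrank, i.e. if and only if $G$ has a $\{1,2\}$-factor.
   Context: All graphs are simple, undirected and finite. A $\{1,2\}$-factor of a graph $G$ is a spanning subgraph of $G$ that is a vertex-disjoint union of copies of $K_2$ and cycles. The perrank of a graph $G$ of order $n$ is the order of its largest subgraph which is a vertex-disjoint union of copies of $K_2$ and cycles; $G$ has full perrank if its perrank equals $n$. A sign of $G$ is a map $\sigma: E(G)\to\{ -1,1\}$; the signed graph is $G^{\sigma}$. For $V(G)=\{v_1,\dots,v_n\}$, the signed adjacency matrix $A(G^{\sigma})=[a_{ij}]$ is the $n\times n$ matrix with $a_{ij}=\sigma(v_iv_j)$ if $v_i$ and $v_j$ are adjacent and $a_{ij}=0$ otherwise. The rank of $G^{\sigma}$ is the rank of $A(G^{\sigma})$. -}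

module Defs where

open import Data.Nat using (ℕ; zero; suc)
open import Data.Bool using (Bool; true; false; if_then_else_)
open import Data.Fin using (Fin)
open import Data.List using (List; map; allFin; foldr)
open import Data.Nat.ListAction using (sum)
open import Data.Product using (Σ; _×_; ∃)
open import Data.Sum using (_⊎_)
open import Data.Sign using (Sign)
open import Data.Rational using (ℚ; 0ℚ; 1ℚ; -_; _+_; _*_)
open import Relation.Binary.PropositionalEquality using (_≡_)

record Graph (n : ℕ) : Set where
  field
    adj     : Fin n → Fin n → Bool
    symm    : ∀ u v → adj u v ≡ adj v u
    irrefl  : ∀ v → adj v v ≡ false
open Graph public

-- A sign of G: a map E(G) → {-1,1}, represented on ordered pairs and
-- required to agree on both orientations of every edge
-- (values on non-edges are irrelevant).
record SignOf {n : ℕ} (G : Graph n) : Set where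
  field
    sgn     : Fin n → Fin n → Sign
    sgnSym  : ∀ u v → adj G u v ≡ true → sgn u v ≡ sgn v u
open SignOf public

signℚ : Sign → ℚ
signℚ Sign.+ = 1ℚ
signℚ Sign.- = - 1ℚ

signedAdj : ∀ {n} (G : Graph n) → SignOf G → Fin n → Fin n → ℚ
signedAdj G σ i j = if adj G i j then signℚ (sgn σ i j) else 0ℚ

Σℚ : ∀ n → (Fin n → ℚ) → ℚ
Σℚ n f = foldr _+_ 0ℚ (map f (allFin n))

-- An n×n matrix over ℚ has full rank (rank n): its n columns are
-- linearly independent over ℚ.
FullRank : ∀ n → (Fin n → Fin n → ℚ) → Set
FullRank n A =
  (c : Fin n → ℚ) → (∀ i → Σℚ n (λ j → A i j * c j) ≡ 0ℚ) → ∀ j → c j ≡ 0ℚ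

deg : ∀ {n} → (Fin n → Fin n → Bool) → Fin n → ℕ
deg {n} H v = sum (map (λ u → if H v u then 1 else 0) (allFin n))

-- A {1,2}-factor of G: a spanning subgraph H of G (same vertex set,
-- E(H) ⊆ E(G)) that is a vertex-disjoint union of copies of K₂ and cycles.
-- For a finite simple graph H this says exactly: every vertex has degree
-- 1 or 2 in H, and the unique H-neighbour of a degree-1 vertex also has
-- degree 1 (so degree-1 components are K₂'s, the others are cycles).
record OneTwoFactor {n : ℕ} (G : Graph n) : Set where
  field
    H        : Fin n → Fin n → Bool
    Hsym     : ∀ u v → H u v ≡ H v u
    H⊆G      : ∀ u v → H u v ≡ true → adj G u v ≡ true
    deg12    : ∀ v → (deg H v ≡ 1) ⊎ (deg H v ≡ 2)
    K₂comp   : ∀ u v → H u v ≡ true → deg H u ≡ 1 → deg H v ≡ 1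

-- Perrank: order of a largest subgraph that is a vertex-disjoint union of
-- K₂'s and cycles. G has full perrank iff such a subgraph has order n,
-- i.e. iff it is spanning, i.e. iff G has a {1,2}-factor.

module Submission where

-- Both sides are shown equivalent to the existence of
-- an edge permutation: a permutation π of V(G) with uπ(u) ∈ E(G) for all u.
--   * full rank ⇒ edge permutation: independent columns have a transversal
--     of nonzero entries, by Gaussian elimination (Columns,
--     PermutationFromFullRank);
--   * edge permutation ⇒ {1,2}-factor: the edges uπ(u) (FactorFromPermutation);
--   * {1,2}-factor ⇒ edge permutation: orient the cycles and turn each K₂
--     into a 2-cycle (PermutationFromFactor);
--   * edge permutation ⇒ nonsingular signing: a character-weighted average of
--     det A(G^s) over all signings s is a nonzero multiple of sign π
--     (NonsingularSigning), using the Leibniz determinant (Transpositions,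
--     Determinants) and the fact that the sign of a permutation is fixed by
--     its cycles of length ≥ 3 up to orientation (SignByPattern).

open import Defs
open import Data.Bool using (Bool; true; false; if_then_else_; _∨_; _∧_; not; _xor_)
import Data.Bool.Properties as BP
open import Data.Empty using (⊥; ⊥-elim)
open import Data.Fin as F using (Fin; zero; suc; punchIn; punchOut)
import Data.Fin.Properties as FP
import Data.Integer as ℤ
import Data.List as L
open import Data.Nat as ℕ using (ℕ; zero; suc; z≤n)
import Data.Nat.ListAction as ℕL
import Data.Nat.Properties as NP
open import Data.Product using (Σ; _×_; _,_; proj₁; proj₂)
open import Data.Rational as Q using (ℚ; 0ℚ; 1ℚ; -_; _+_; _*_; 1/_)
import Data.Rational.Properties as QP
open import Data.Rational.Solver using (module +-*-Solver)
open +-*-Solver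
open import Data.Sign using (Sign)
import Data.Sign as Sg
import Data.Sign.Properties as SgP
open import Data.Sum using (_⊎_; inj₁; inj₂; [_,_]′)
import Data.Sum as Sum
open import Data.Vec.Functional using () renaming (_∷_ to _∷ᶠ_)
open import Data.Vec using (Vec; []; _∷_; lookup; tabulate)
import Data.Vec.Properties as VP
open import Function using (id)
open import Function.Bundles using (_⇔_; mk⇔)
open import Relation.Binary.PropositionalEquality
open import Relation.Nullary using (¬_; yes; no)
open import Algebra.Bundles using (Ring)
open import Algebra.Properties.Semiring.Sum (Ring.semiring QP.+-*-ring)
  using (sum; sum-cong-≗; ∑-distrib-+; ∑-comm; *-distribˡ-sum; sum-replicate-zero)
open import Algebra.Properties.CommutativeMonoid.Sum QP.*-1-commutativeMonoid
  using () renaming (sum to prod; sum-cong-≗ to prod-cong-≗; sum-replicate-zero to prod-replicate-one;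
                     ∑-distrib-+ to ∏-distrib-*; ∑-comm to ∏-comm)

module Basics where

  -- Both unfold definitionally: ∑ (suc n) f = f zero + ∑ n (f ∘ suc).
  ∑ : ∀ n → (Fin n → ℚ) → ℚ
  ∑ n = sum

  ∏ : ∀ n → (Fin n → ℚ) → ℚ
  ∏ n = prod

  ∑-cong : ∀ n {f g : Fin n → ℚ} → (∀ i → f i ≡ g i) → ∑ n f ≡ ∑ n g
  ∑-cong n = sum-cong-≗

  ∑-zero : ∀ n {f : Fin n → ℚ} → (∀ i → f i ≡ 0ℚ) → ∑ n f ≡ 0ℚ
  ∑-zero n e = trans (sum-cong-≗ e) (sum-replicate-zero n)

  ∑-+ : ∀ n (f g : Fin n → ℚ) → ∑ n (λ i → f i + g i) ≡ ∑ n f + ∑ n g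
  ∑-+ n = ∑-distrib-+

  ∑-*ˡ : ∀ n c (f : Fin n → ℚ) → ∑ n (λ i → c * f i) ≡ c * ∑ n f
  ∑-*ˡ n c f = sym (*-distribˡ-sum c f)

  ∑-swap : ∀ m n (F : Fin m → Fin n → ℚ) → ∑ m (λ i → ∑ n (F i)) ≡ ∑ n (λ j → ∑ m (λ i → F i j))
  ∑-swap m n = ∑-comm

  ∑-single : ∀ n (f : Fin n → ℚ) k → (∀ i → i ≢ k → f i ≡ 0ℚ) → ∑ n f ≡ f k
  ∑-single (suc n) f zero h = trans (cong (f zero +_) (∑-zero n (λ i → h (suc i) (λ ())))) (QP.+-identityʳ _)
  ∑-single (suc n) f (suc k) h =
    trans (cong₂ _+_ (h zero (λ ())) (∑-single n _ k (λ i i≢k → h (suc i) (λ e → i≢k (FP.suc-injective e)))))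
          (QP.+-identityˡ _)

  ∏-cong : ∀ n {f g : Fin n → ℚ} → (∀ i → f i ≡ g i) → ∏ n f ≡ ∏ n g
  ∏-cong n = prod-cong-≗

  ∏-one : ∀ n {f : Fin n → ℚ} → (∀ i → f i ≡ 1ℚ) → ∏ n f ≡ 1ℚ
  ∏-one n e = trans (prod-cong-≗ e) (prod-replicate-one n)

  ∏-* : ∀ n (f g : Fin n → ℚ) → ∏ n (λ i → f i * g i) ≡ ∏ n f * ∏ n g
  ∏-* n = ∏-distrib-*

  ∏-swap : ∀ m n (F : Fin m → Fin n → ℚ) → ∏ m (λ i → ∏ n (F i)) ≡ ∏ n (λ j → ∏ m (λ i → F i j))
  ∏-swap m n = ∏-comm

  inverse : ∀ p → p ≢ 0ℚ → Σ ℚ λ q → q * p ≡ 1ℚ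
  inverse p p≢0 = let instance _ = Q.≢-nonZero p≢0 in 1/ p , QP.*-inverseˡ p

  cancel-nonzero : ∀ x y → x ≢ 0ℚ → x * y ≡ 0ℚ → y ≡ 0ℚ
  cancel-nonzero x y x≢0 e with inverse x x≢0
  ... | q , qx = begin
    y           ≡⟨ sym (QP.*-identityˡ y) ⟩
    1ℚ * y      ≡⟨ cong (_* y) (sym qx) ⟩
    q * x * y   ≡⟨ QP.*-assoc q x y ⟩
    q * (x * y) ≡⟨ cong (q *_) e ⟩
    q * 0ℚ      ≡⟨ QP.*-zeroʳ q ⟩
    0ℚ          ∎
    where open ≡-Reasoning

  *-nonzero : ∀ x y → x ≢ 0ℚ → y ≢ 0ℚ → x * y ≢ 0ℚ
  *-nonzero x y x≢0 y≢0 e = y≢0 (cancel-nonzero x y x≢0 e)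

  ∏-zero : ∀ n (f : Fin n → ℚ) k → f k ≡ 0ℚ → ∏ n f ≡ 0ℚ
  ∏-zero (suc n) f zero e = trans (cong (_* ∏ n (λ i → f (suc i))) e) (QP.*-zeroˡ (∏ n (λ i → f (suc i))))
  ∏-zero (suc n) f (suc k) e = trans (cong (f zero *_) (∏-zero n _ k e)) (QP.*-zeroʳ (f zero))

  ∏-nonzero : ∀ n (f : Fin n → ℚ) → (∀ i → f i ≢ 0ℚ) → ∏ n f ≢ 0ℚ
  ∏-nonzero zero f h ()
  ∏-nonzero (suc n) f h = *-nonzero _ _ (h zero) (∏-nonzero n (λ i → f (suc i)) (λ i → h (suc i)))

  zero-or-nonzero : ∀ x → (x ≢ 0ℚ) ⊎ (x ≡ 0ℚ)
  zero-or-nonzero x with x QP.≟ 0ℚ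
  ... | yes e = inj₂ e
  ... | no n = inj₁ n

  *≢0ʳ : ∀ x y → x * y ≢ 0ℚ → y ≢ 0ℚ
  *≢0ʳ x y nz e = nz (trans (cong (x *_) e) (QP.*-zeroʳ x))

  *≢0ˡ : ∀ x y → x * y ≢ 0ℚ → x ≢ 0ℚ
  *≢0ˡ x y nz e = nz (trans (cong (_* y) e) (QP.*-zeroˡ y))

  1≢0 : 1ℚ ≢ 0ℚ
  1≢0 ()

  -1≢0 : - 1ℚ ≢ 0ℚ
  -1≢0 ()

  search : ∀ n {P Q : Fin n → Set} → (∀ i → P i ⊎ Q i) → (Σ (Fin n) P) ⊎ (∀ i → Q i)
  search zero d = inj₂ (λ ())
  search (suc n) d with d zero | search n (λ i → d (suc i))
  ... | inj₁ p | _ = inj₁ (zero , p)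
  ... | inj₂ q | inj₁ (i , p) = inj₁ (suc i , p)
  ... | inj₂ q | inj₂ qs = inj₂ λ { zero → q ; (suc i) → qs i }

  punchIn-cases : ∀ {m} (r : Fin (suc m)) {P : Fin (suc m) → Set} → P r → (∀ i → P (punchIn r i)) → ∀ i → P i
  punchIn-cases r {P} pr pi i with i F.≟ r
  ... | yes refl = pr
  ... | no i≢r = subst P (FP.punchIn-punchOut (λ e → i≢r (sym e))) (pi (punchOut (λ e → i≢r (sym e))))

  IsInjective : ∀ {a b} → (Fin a → Fin b) → Set
  IsInjective f = ∀ x y → f x ≡ f y → x ≡ y


module Columns where
  open Basics

  Matrix : ℕ → ℕ → Set
  Matrix m k = Fin m → Fin k → ℚ

  _·_ : ∀ {m k} → Matrix m k → (Fin k → ℚ) → Fin m → ℚ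
  (_·_ {k = k} A c) i = ∑ k (λ j → A i j * c j)

  Independent : ∀ m k → Matrix m k → Set
  Independent m k A = ∀ c → (∀ i → (A · c) i ≡ 0ℚ) → ∀ j → c j ≡ 0ℚ

  Dependent : ∀ m k → Matrix m k → Set
  Dependent m k A = Σ (Fin k → ℚ) λ c → (∀ i → (A · c) i ≡ 0ℚ) × Σ (Fin k) λ j → c j ≢ 0ℚ

  e₀ : ∀ {k} → Fin (suc k) → ℚ
  e₀ = 1ℚ ∷ᶠ (λ _ → 0ℚ)

  e₀-kernel : ∀ {m k} (A : Matrix m (suc k)) → (∀ i → A i zero ≡ 0ℚ) → ∀ i → (A · e₀) i ≡ 0ℚ
  e₀-kernel {k = k} A z i =
    trans (cong₂ _+_ (trans (QP.*-identityʳ _) (z i)) (∑-zero k (λ j → QP.*-zeroʳ (A i (suc j)))))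
          (QP.+-identityˡ 0ℚ)

  ∑-sub-scaled : ∀ k (x y d : Fin k → ℚ) l →
    ∑ k (λ j → (x j + - (l * y j)) * d j) ≡ ∑ k (λ j → x j * d j) + - (l * ∑ k (λ j → y j * d j))
  ∑-sub-scaled k x y d l = begin
    ∑ k (λ j → (x j + - (l * y j)) * d j)
      ≡⟨ ∑-cong k (λ j → solve 4 (λ X Y D L → (X :+ :- (L :* Y)) :* D := X :* D :+ (:- L) :* (Y :* D)) refl (x j) (y j) (d j) l) ⟩
    ∑ k (λ j → x j * d j + (- l) * (y j * d j))                ≡⟨ ∑-+ k _ _ ⟩
    ∑ k (λ j → x j * d j) + ∑ k (λ j → (- l) * (y j * d j))    ≡⟨ cong (∑ k (λ j → x j * d j) +_) (∑-*ˡ k (- l) _) ⟩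
    ∑ k (λ j → x j * d j) + (- l) * ∑ k (λ j → y j * d j)
      ≡⟨ cong (∑ k (λ j → x j * d j) +_) (solve 2 (λ L T → (:- L) :* T := :- (L :* T)) refl l _) ⟩
    ∑ k (λ j → x j * d j) + - (l * ∑ k (λ j → y j * d j))     ∎
    where open ≡-Reasoning

  -- One step of Gaussian elimination with pivot Aᵣ₀ (q its inverse):
  -- clear column 0 from every other row, then drop row r and column 0.
  eliminate : ∀ {m k} (A : Matrix (suc m) (suc k)) (r : Fin (suc m)) (q : ℚ) → Matrix m k
  eliminate A r q i j = A (punchIn r i) (suc j) + - ((A (punchIn r i) zero * q) * A r (suc j))

  module Pivot {m k} (A : Matrix (suc m) (suc k)) (r : Fin (suc m)) (pivot≢0 : A r zero ≢ 0ℚ)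
               (q : ℚ) (q-inv : q * A r zero ≡ 1ℚ) where
    open ≡-Reasoning

    eliminated-row : ∀ d i → (eliminate A r q · d) i
      ≡ ∑ k (λ j → A (punchIn r i) (suc j) * d j) + - ((A (punchIn r i) zero * q) * ∑ k (λ j → A r (suc j) * d j))
    eliminated-row d i = ∑-sub-scaled k (λ j → A (punchIn r i) (suc j)) (λ j → A r (suc j)) d (A (punchIn r i) zero * q)

    lift-dependence : Dependent m k (eliminate A r q) → Dependent (suc m) (suc k) A
    lift-dependence (d , d-kernel , j , dj≢0) = c , c-kernel , suc j , dj≢0
      where
       Sr = ∑ k (λ j → A r (suc j) * d j)
       c = (- (q * Sr)) ∷ᶠ d
       pivot-row : (A · c) r ≡ 0ℚ
       pivot-row = begin
           A r zero * - (q * Sr) + Sr    ≡⟨ solve 3 (λ a q s → a :* (:- (q :* s)) :+ s := s :+ :- ((q :* a) :* s)) refl (A r zero) q Sr ⟩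
           Sr + - ((q * A r zero) * Sr)  ≡⟨ cong (λ t → Sr + - (t * Sr)) q-inv ⟩
           Sr + - (1ℚ * Sr)              ≡⟨ solve 1 (λ s → s :+ :- (con 1ℚ :* s) := con 0ℚ) refl Sr ⟩
           0ℚ                            ∎
       other-row : ∀ i → (A · c) (punchIn r i) ≡ 0ℚ
       other-row i = begin
           a * - (q * Sr) + Si             ≡⟨ solve 4 (λ a q s t → a :* (:- (q :* s)) :+ t := t :+ :- ((a :* q) :* s)) refl a q Sr Si ⟩
           Si + - ((a * q) * Sr)           ≡⟨ sym (eliminated-row d i) ⟩
           (eliminate A r q · d) i         ≡⟨ d-kernel i ⟩
           0ℚ                              ∎
         where a = A (punchIn r i) zero
               Si = ∑ k (λ j → A (punchIn r i) (suc j) * d j)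
       c-kernel : ∀ i → (A · c) i ≡ 0ℚ
       c-kernel = punchIn-cases r pivot-row other-row

    lift-independence : Independent m k (eliminate A r q) → Independent (suc m) (suc k) A
    lift-independence indB c c-kernel = c≡0
      where
       d = λ j → c (suc j)
       c0 = c zero
       Sr = ∑ k (λ j → A r (suc j) * d j)
       d-kernel : ∀ i → (eliminate A r q · d) i ≡ 0ℚ
       d-kernel i = begin
           (eliminate A r q · d) i ≡⟨ eliminated-row d i ⟩
           Si + - ((a * q) * Sr)
             ≡⟨ solve 6 (λ a q s t c0 ar → t :+ :- ((a :* q) :* s)
                   := (a :* c0 :+ t) :+ :- ((a :* q) :* (ar :* c0 :+ s)) :+ (a :* c0) :* (q :* ar) :+ :- (a :* c0))
                 refl a q Sr Si c0 (A r zero) ⟩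
           (a * c0 + Si) + - ((a * q) * (A r zero * c0 + Sr)) + (a * c0) * (q * A r zero) + - (a * c0)
             ≡⟨ cong₂ (λ u v → u + - ((a * q) * v) + (a * c0) * (q * A r zero) + - (a * c0)) (c-kernel (punchIn r i)) (c-kernel r) ⟩
           0ℚ + - ((a * q) * 0ℚ) + (a * c0) * (q * A r zero) + - (a * c0)
             ≡⟨ cong (λ t → 0ℚ + - ((a * q) * 0ℚ) + (a * c0) * t + - (a * c0)) q-inv ⟩
           0ℚ + - ((a * q) * 0ℚ) + (a * c0) * 1ℚ + - (a * c0)
             ≡⟨ solve 2 (λ x y → con 0ℚ :+ :- (x :* con 0ℚ) :+ y :* con 1ℚ :+ :- y := con 0ℚ) refl (a * q) (a * c0) ⟩
           0ℚ ∎
         where a = A (punchIn r i) zero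
               Si = ∑ k (λ j → A (punchIn r i) (suc j) * d j)
       d≡0 : ∀ j → d j ≡ 0ℚ
       d≡0 = indB d d-kernel
       Sr≡0 : Sr ≡ 0ℚ
       Sr≡0 = ∑-zero k (λ j → trans (cong (A r (suc j) *_) (d≡0 j)) (QP.*-zeroʳ (A r (suc j))))
       c0≡0 : c0 ≡ 0ℚ
       c0≡0 = cancel-nonzero (A r zero) c0 pivot≢0
                (trans (sym (QP.+-identityʳ _)) (trans (cong (A r zero * c0 +_) (sym Sr≡0)) (c-kernel r)))
       c≡0 : ∀ j → c j ≡ 0ℚ
       c≡0 zero = c0≡0
       c≡0 (suc j) = d≡0 j

  dependent-or-independent : ∀ m k (A : Matrix m k) → Dependent m k A ⊎ Independent m k A
  dependent-or-independent m zero A = inj₂ (λ c _ ())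
  dependent-or-independent zero (suc k) A = inj₁ (e₀ , (λ ()) , zero , 1≢0)
  dependent-or-independent (suc m) (suc k) A with search (suc m) (λ r → zero-or-nonzero (A r zero))
  ... | inj₂ col0≡0 = inj₁ (e₀ , e₀-kernel A col0≡0 , zero , 1≢0)
  ... | inj₁ (r , pivot≢0) with inverse (A r zero) pivot≢0
  ...   | q , q-inv with dependent-or-independent m k (eliminate A r q)
  ...     | inj₁ dep = inj₁ (Pivot.lift-dependence A r pivot≢0 q q-inv dep)
  ...     | inj₂ ind = inj₂ (Pivot.lift-independence A r pivot≢0 q q-inv ind)

  minor : ∀ {m k} → Matrix (suc m) (suc k) → Fin (suc m) → Matrix m k
  minor A r i j = A (punchIn r i) (suc j)

  -- Row r is a good place to expand along column 0 if the entry is nonzero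
  -- and the complementary minor still has independent columns.
  GoodRow : ∀ {m k} → Matrix (suc m) (suc k) → Fin (suc m) → Set
  GoodRow A r = A r zero ≢ 0ℚ × Independent _ _ (minor A r)

  BadRow : ∀ {m k} → Matrix (suc m) (suc k) → Fin (suc m) → Set
  BadRow A r = A r zero ≡ 0ℚ ⊎ (A r zero ≢ 0ℚ × Dependent _ _ (minor A r))

  good-or-bad : ∀ {m k} (A : Matrix (suc m) (suc k)) r → GoodRow A r ⊎ BadRow A r
  good-or-bad A r with zero-or-nonzero (A r zero)
  ... | inj₂ z = inj₂ (inj₁ z)
  ... | inj₁ nz with dependent-or-independent _ _ (minor A r)
  ...   | inj₁ dep = inj₂ (inj₂ (nz , dep))
  ...   | inj₂ ind = inj₁ (nz , ind)

  -- (Ã d)ᵢ for the matrix Ã of the columns 1..k of A.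
  tail· : ∀ {m k} (A : Matrix (suc m) (suc k)) → (Fin k → ℚ) → Fin (suc m) → ℚ
  tail· {k = k} A d i = ∑ k (λ j → A i (suc j) * d j)

  -- The vector Aᵣ₀·eᵣ is a combination μ·(Ã d) of the columns 1..k.
  SpannedAt : ∀ {m k} (A : Matrix (suc m) (suc k)) → Fin (suc m) → Set
  SpannedAt {k = k} A r =
    Σ (Fin k → ℚ) λ d → Σ ℚ λ μ → (∀ i → i ≢ r → μ * tail· A d i ≡ 0ℚ) × (μ * tail· A d r ≡ A r zero)

  -- For independent A a bad row r yields such a combination: either
  -- Aᵣ₀ = 0 (take μ = 0), or a kernel vector d of the minor, for which Ã d
  -- is supported at r with a nonzero value (else (0, d) ∈ ker A).
  bad-row-spanned : ∀ {m k} (A : Matrix (suc m) (suc k)) → Independent (suc m) (suc k) A →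
    ∀ r → BadRow A r → SpannedAt A r
  bad-row-spanned A ind r (inj₁ z) =
    (λ _ → 0ℚ) , 0ℚ , (λ i _ → QP.*-zeroˡ (tail· A (λ _ → 0ℚ) i)) , trans (QP.*-zeroˡ (tail· A (λ _ → 0ℚ) r)) (sym z)
  bad-row-spanned A ind r (inj₂ (nz , d , d-kernel , j , dj≢0)) = d , A r zero * q , off-r , at-r
    where
     y = tail· A d r
     off-r≡0 : ∀ i → i ≢ r → tail· A d i ≡ 0ℚ
     off-r≡0 i i≢r = subst (λ t → tail· A d t ≡ 0ℚ) (FP.punchIn-punchOut (λ e → i≢r (sym e))) (d-kernel (punchOut (λ e → i≢r (sym e))))
     y≢0 : y ≢ 0ℚ
     y≢0 y≡0 = dj≢0 (ind (0ℚ ∷ᶠ d) kernel (suc j))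
       where kernel : ∀ i → (A · (0ℚ ∷ᶠ d)) i ≡ 0ℚ
             kernel = punchIn-cases r (trans (cong₂ _+_ (QP.*-zeroʳ (A r zero)) y≡0) (QP.+-identityˡ 0ℚ))
               (λ i → trans (cong₂ _+_ (QP.*-zeroʳ (A (punchIn r i) zero)) (off-r≡0 (punchIn r i) (FP.punchInᵢ≢i r i))) (QP.+-identityˡ 0ℚ))
     q = proj₁ (inverse y y≢0)
     off-r : ∀ i → i ≢ r → A r zero * q * tail· A d i ≡ 0ℚ
     off-r i i≢r = trans (cong (A r zero * q *_) (off-r≡0 i i≢r)) (QP.*-zeroʳ (A r zero * q))
     at-r : A r zero * q * y ≡ A r zero
     at-r = trans (QP.*-assoc (A r zero) q y) (trans (cong (A r zero *_) (proj₂ (inverse y y≢0))) (QP.*-identityʳ (A r zero)))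

  -- If every row were bad, column 0 would equal ∑ᵣ μᵣ (Ã dᵣ), a combination
  -- of the other columns, contradicting independence.
  some-good-row : ∀ {m k} (A : Matrix (suc m) (suc k)) → Independent (suc m) (suc k) A → (∀ r → BadRow A r) → ⊥
  some-good-row {m} {k} A ind bad = -1≢0 (ind c c-kernel zero)
    where
     open ≡-Reasoning
     P = λ r → bad-row-spanned A ind r (bad r)
     d = λ r → proj₁ (P r)
     μ = λ r → proj₁ (proj₂ (P r))
     c = (- 1ℚ) ∷ᶠ (λ j → ∑ (suc m) (λ r → μ r * d r j))
     column0 : ∀ i → ∑ k (λ j → A i (suc j) * ∑ (suc m) (λ r → μ r * d r j)) ≡ A i zero
     column0 i = begin
       ∑ k (λ j → A i (suc j) * ∑ (suc m) (λ r → μ r * d r j))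
         ≡⟨ ∑-cong k (λ j → sym (∑-*ˡ (suc m) (A i (suc j)) (λ r → μ r * d r j))) ⟩
       ∑ k (λ j → ∑ (suc m) (λ r → A i (suc j) * (μ r * d r j)))
         ≡⟨ sym (∑-swap (suc m) k (λ r j → A i (suc j) * (μ r * d r j))) ⟩
       ∑ (suc m) (λ r → ∑ k (λ j → A i (suc j) * (μ r * d r j)))
         ≡⟨ ∑-cong (suc m) (λ r → trans (∑-cong k (λ j → solve 3 (λ a u v → a :* (u :* v) := u :* (a :* v)) refl (A i (suc j)) (μ r) (d r j)))
                                         (∑-*ˡ k (μ r) (λ j → A i (suc j) * d r j))) ⟩
       ∑ (suc m) (λ r → μ r * tail· A (d r) i)
         ≡⟨ ∑-single (suc m) (λ r → μ r * tail· A (d r) i) i (λ r r≢i → proj₁ (proj₂ (proj₂ (P r))) i (λ e → r≢i (sym e))) ⟩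
       μ i * tail· A (d i) i ≡⟨ proj₂ (proj₂ (proj₂ (P i))) ⟩
       A i zero ∎
     c-kernel : ∀ i → (A · c) i ≡ 0ℚ
     c-kernel i = trans (cong (A i zero * - 1ℚ +_) (column0 i))
                        (solve 1 (λ a → a :* (:- con 1ℚ) :+ a := con 0ℚ) refl (A i zero))

  -- Independent columns admit a transversal of nonzero entries: an
  -- injective choice of row f j for each column j with A (f j) j ≠ 0
  -- (expand along column 0 at a good row and recurse into the minor).
  nonzero-transversal : ∀ m k (A : Matrix m k) → Independent m k A →
    Σ (Fin k → Fin m) λ f → IsInjective f × (∀ j → A (f j) j ≢ 0ℚ)
  nonzero-transversal m zero A ind = (λ ()) , (λ ()) , (λ ())
  nonzero-transversal zero (suc k) A ind = ⊥-elim (1≢0 (ind e₀ (λ ()) zero))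
  nonzero-transversal (suc m) (suc k) A ind with search (suc m) (good-or-bad A)
  ... | inj₂ bad = ⊥-elim (some-good-row A ind bad)
  ... | inj₁ (r , nz , minor-ind) with nonzero-transversal m k (minor A r) minor-ind
  ...   | g , g-inj , g≢0 = f , f-inj , f≢0
    where
     f : Fin (suc k) → Fin (suc m)
     f zero = r
     f (suc j) = punchIn r (g j)
     f-inj : IsInjective f
     f-inj zero zero _ = refl
     f-inj zero (suc y) e = ⊥-elim (FP.punchInᵢ≢i r (g y) (sym e))
     f-inj (suc x) zero e = ⊥-elim (FP.punchInᵢ≢i r (g x) e)
     f-inj (suc x) (suc y) e = cong suc (g-inj x y (FP.punchIn-injective r _ _ e))
     f≢0 : ∀ j → A (f j) j ≢ 0ℚ
     f≢0 zero = nz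
     f≢0 (suc j) = g≢0 j


module Counting where
  open Basics

  -- Boolean equality on Fin, by structural recursion so that it computes
  -- on successors: eqb (suc a) (suc b) reduces to eqb a b.
  eqb : ∀ {n} → Fin n → Fin n → Bool
  eqb zero zero = true
  eqb zero (suc _) = false
  eqb (suc _) zero = false
  eqb (suc a) (suc b) = eqb a b

  eqb-true : ∀ {n} (a b : Fin n) → eqb a b ≡ true → a ≡ b
  eqb-true zero zero _ = refl
  eqb-true zero (suc b) ()
  eqb-true (suc a) zero ()
  eqb-true (suc a) (suc b) e = cong suc (eqb-true a b e)

  eqb-refl : ∀ {n} (a : Fin n) → eqb a a ≡ true
  eqb-refl zero = refl
  eqb-refl (suc a) = eqb-refl a

  eqb-false : ∀ {n} (a b : Fin n) → a ≢ b → eqb a b ≡ false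
  eqb-false zero zero ne = ⊥-elim (ne refl)
  eqb-false zero (suc b) ne = refl
  eqb-false (suc a) zero ne = refl
  eqb-false (suc a) (suc b) ne = eqb-false a b (λ e → ne (cong suc e))

  false≢true : false ≢ true
  false≢true ()

  true-or-false : ∀ b → b ≡ true ⊎ b ≡ false
  true-or-false true = inj₁ refl
  true-or-false false = inj₂ refl

  some-true-or-all-false : ∀ {n} (b : Fin n → Fin n → Bool) →
    (Σ (Fin n) λ u → Σ (Fin n) λ v → b u v ≡ true) ⊎ (∀ u v → b u v ≡ false)
  some-true-or-all-false {n} b = search n (λ u → search n (λ v → true-or-false (b u v)))

  ∨-true : ∀ a b → a ∨ b ≡ true → a ≡ true ⊎ b ≡ true
  ∨-true true b _ = inj₁ refl
  ∨-true false b e = inj₂ e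

  xor≡false⇒≡ : ∀ a b → a xor b ≡ false → a ≡ b
  xor≡false⇒≡ true true _ = refl
  xor≡false⇒≡ false false _ = refl
  xor≡false⇒≡ true false ()
  xor≡false⇒≡ false true ()

  ≡-or-≢ : ∀ {n} (a b : Fin n) → (a ≡ b) ⊎ (a ≢ b)
  ≡-or-≢ a b with a F.≟ b
  ... | yes e = inj₁ e
  ... | no ne = inj₂ ne

  bit : Bool → ℕ
  bit b = if b then 1 else 0

  count : ∀ n → (Fin n → Bool) → ℕ
  count zero b = 0
  count (suc n) b = bit (b zero) ℕ.+ count n (λ i → b (suc i))

  count-cong : ∀ n {b c : Fin n → Bool} → (∀ i → b i ≡ c i) → count n b ≡ count n c
  count-cong zero e = refl
  count-cong (suc n) e = cong₂ ℕ._+_ (cong bit (e zero)) (count-cong n (λ i → e (suc i)))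

  count-false : ∀ n → count n (λ _ → false) ≡ 0
  count-false zero = refl
  count-false (suc n) = count-false n

  count-eqb : ∀ n (p : Fin n) → count n (λ v → eqb p v) ≡ 1
  count-eqb (suc n) zero = cong suc (count-false n)
  count-eqb (suc n) (suc p) = count-eqb n p

  count-eqb-or : ∀ n (p q : Fin n) → count n (λ v → eqb p v ∨ eqb q v) ≡ (if eqb p q then 1 else 2)
  count-eqb-or (suc n) zero zero = cong suc (count-false n)
  count-eqb-or (suc n) zero (suc q) = cong suc (count-eqb n q)
  count-eqb-or (suc n) (suc p) zero = cong suc (trans (count-cong n (λ v → BP.∨-identityʳ (eqb p v))) (count-eqb n p))
  count-eqb-or (suc n) (suc p) (suc q) = count-eqb-or n p q

  count-suc : ∀ n (b : Fin (suc n) → Bool) →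
    (b zero ≡ true × count (suc n) b ≡ suc (count n (λ i → b (suc i)))) ⊎ (b zero ≡ false × count (suc n) b ≡ count n (λ i → b (suc i)))
  count-suc n b with true-or-false (b zero)
  ... | inj₁ e = inj₁ (e , cong (λ t → bit t ℕ.+ count n (λ i → b (suc i))) e)
  ... | inj₂ e = inj₂ (e , cong (λ t → bit t ℕ.+ count n (λ i → b (suc i))) e)

  count≡0⇒ : ∀ n (b : Fin n → Bool) → count n b ≡ 0 → ∀ v → b v ≡ false
  count≡0⇒ (suc n) b h v with count-suc n b
  ... | inj₁ (bz , eq) = ⊥-elim (NP.1+n≢0 (trans (sym eq) h))
  count≡0⇒ (suc n) b h zero | inj₂ (bz , eq) = bz
  count≡0⇒ (suc n) b h (suc v) | inj₂ (bz , eq) = count≡0⇒ n _ (trans (sym eq) h) v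

  count≡1⇒ : ∀ n (b : Fin n → Bool) → count n b ≡ 1 → Σ (Fin n) λ p → b p ≡ true × (∀ v → b v ≡ true → v ≡ p)
  count≡1⇒ zero b ()
  count≡1⇒ (suc n) b h with count-suc n b
  ... | inj₁ (bz , eq) = zero , bz , only-zero
    where rest≡0 = count≡0⇒ n _ (NP.suc-injective (trans (sym eq) h))
          only-zero : ∀ v → b v ≡ true → v ≡ zero
          only-zero zero _ = refl
          only-zero (suc v) hv = ⊥-elim (false≢true (trans (sym (rest≡0 v)) hv))
  ... | inj₂ (bz , eq) with count≡1⇒ n _ (trans (sym eq) h)
  ...   | p , hp , only-p = suc p , hp , only-suc-p
    where only-suc-p : ∀ v → b v ≡ true → v ≡ suc p
          only-suc-p zero hv = ⊥-elim (false≢true (trans (sym bz) hv))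
          only-suc-p (suc v) hv = cong suc (only-p v hv)

  count≡2⇒ : ∀ n (b : Fin n → Bool) → count n b ≡ 2 →
    Σ (Fin n) λ p → Σ (Fin n) λ q → p ≢ q × b p ≡ true × b q ≡ true × (∀ v → b v ≡ true → v ≡ p ⊎ v ≡ q)
  count≡2⇒ zero b ()
  count≡2⇒ (suc n) b h with count-suc n b
  ... | inj₁ (bz , eq) with count≡1⇒ n _ (NP.suc-injective (trans (sym eq) h))
  ...   | q , hq , only-q = zero , suc q , (λ ()) , bz , hq , only
    where only : ∀ v → b v ≡ true → v ≡ zero ⊎ v ≡ suc q
          only zero _ = inj₁ refl
          only (suc v) hv = inj₂ (cong suc (only-q v hv))
  count≡2⇒ (suc n) b h | inj₂ (bz , eq) with count≡2⇒ n _ (trans (sym eq) h)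
  ...   | p , q , p≢q , hp , hq , only-pq = suc p , suc q , (λ e → p≢q (FP.suc-injective e)) , hp , hq , only
    where only : ∀ v → b v ≡ true → v ≡ suc p ⊎ v ≡ suc q
          only zero hv = ⊥-elim (false≢true (trans (sym bz) hv))
          only (suc v) hv = Sum.map (cong suc) (cong suc) (only-pq v hv)

  injective⇒surjective : ∀ {n} (f : Fin n → Fin n) → IsInjective f → ∀ y → Σ (Fin n) λ x → f x ≡ y
  injective⇒surjective {suc n} f f-inj y with search (suc n) {P = λ x → f x ≡ y} {Q = λ x → f x ≢ y} (λ x → ≡-or-≢ (f x) y)
  ... | inj₁ r = r
  ... | inj₂ ne with FP.pigeonhole (NP.n<1+n n) (λ x → punchOut {i = y} (λ e → ne x (sym e)))
  ...   | i , j , i<j , e = ⊥-elim (FP.<-irrefl (f-inj i j (FP.punchOut-injective (λ e → ne i (sym e)) (λ e → ne j (sym e)) e)) i<j)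


module Graphs where
  open Basics
  open Counting

  deg-tabulate : ∀ n {m} (g : Fin n → Fin m) (b : Fin m → Bool) →
    ℕL.sum (L.map (λ u → if b u then 1 else 0) (L.tabulate g)) ≡ count n (λ i → b (g i))
  deg-tabulate zero g b = refl
  deg-tabulate (suc n) g b = cong (bit (b (g zero)) ℕ.+_) (deg-tabulate n (λ i → g (suc i)) b)

  deg≡count : ∀ {n} (H : Fin n → Fin n → Bool) v → deg H v ≡ count n (H v)
  deg≡count {n} H v = deg-tabulate n id (H v)

  Σℚ-tabulate : ∀ n {m} (g : Fin n → Fin m) (f : Fin m → ℚ) → L.foldr _+_ 0ℚ (L.map f (L.tabulate g)) ≡ ∑ n (λ i → f (g i))
  Σℚ-tabulate zero g f = refl
  Σℚ-tabulate (suc n) g f = cong (f (g zero) +_) (Σℚ-tabulate n (λ i → g (suc i)) f)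

  Σℚ≡∑ : ∀ n (f : Fin n → ℚ) → Σℚ n f ≡ ∑ n f
  Σℚ≡∑ n f = Σℚ-tabulate n id f

  if-false-0 : ∀ b (s : ℚ) → b ≡ false → (if b then s else 0ℚ) ≡ 0ℚ
  if-false-0 .false s refl = refl

  nonzero-entry⇒adj : ∀ {n} (G : Graph n) σ i j → signedAdj G σ i j ≢ 0ℚ → adj G i j ≡ true
  nonzero-entry⇒adj G σ i j nz with true-or-false (adj G i j)
  ... | inj₁ e = e
  ... | inj₂ e = ⊥-elim (nz (if-false-0 (adj G i j) _ e))

  -- A permutation of V(G) sending every vertex to a neighbour.  Both
  -- conditions of the theorem turn out to be equivalent to its existence.
  record EdgePermutation {n : ℕ} (G : Graph n) : Set where
    field
      perm      : Fin n → Fin n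
      injective : IsInjective perm
      along-edge : ∀ i → adj G i (perm i) ≡ true


-- A permutation along edges yields a {1,2}-factor: H = {uπ(u)}.  A vertex
-- has H-degree 1 when π(u) = π⁻¹(u) (a 2-cycle, i.e. a K₂) and 2 otherwise.
module FactorFromPermutation {n} (G : Graph n) (P : Graphs.EdgePermutation G) where
  open Basics
  open Counting
  open Graphs
  open EdgePermutation P renaming (perm to π)

  π⁻¹ : Fin n → Fin n
  π⁻¹ u = proj₁ (injective⇒surjective π injective u)

  π∘π⁻¹ : ∀ u → π (π⁻¹ u) ≡ u
  π∘π⁻¹ u = proj₂ (injective⇒surjective π injective u)

  H : Fin n → Fin n → Bool
  H u v = eqb (π u) v ∨ eqb (π v) u

  π-eqb-π⁻¹ : ∀ u v → eqb (π v) u ≡ eqb (π⁻¹ u) v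
  π-eqb-π⁻¹ u v with ≡-or-≢ v (π⁻¹ u)
  ... | inj₁ refl = trans (cong (λ t → eqb t u) (π∘π⁻¹ u)) (trans (eqb-refl u) (sym (eqb-refl (π⁻¹ u))))
  ... | inj₂ ne = trans (eqb-false (π v) u (λ e → ne (injective v (π⁻¹ u) (trans e (sym (π∘π⁻¹ u))))))
                        (sym (eqb-false (π⁻¹ u) v (λ e → ne (sym e))))

  H-neighbours : ∀ u v → H u v ≡ eqb (π u) v ∨ eqb (π⁻¹ u) v
  H-neighbours u v = cong (eqb (π u) v ∨_) (π-eqb-π⁻¹ u v)

  deg-H : ∀ u → deg H u ≡ (if eqb (π u) (π⁻¹ u) then 1 else 2)
  deg-H u = trans (deg≡count H u) (trans (count-cong n (H-neighbours u)) (count-eqb-or n (π u) (π⁻¹ u)))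

  H-sym : ∀ u v → H u v ≡ H v u
  H-sym u v = BP.∨-comm (eqb (π u) v) (eqb (π v) u)

  H⊆G : ∀ u v → H u v ≡ true → adj G u v ≡ true
  H⊆G u v h with ∨-true _ _ h
  ... | inj₁ e = subst (λ t → adj G u t ≡ true) (eqb-true _ _ e) (along-edge u)
  ... | inj₂ e = trans (symm G u v) (subst (λ t → adj G v t ≡ true) (eqb-true _ _ e) (along-edge v))

  deg-1-or-2 : ∀ v → (deg H v ≡ 1) ⊎ (deg H v ≡ 2)
  deg-1-or-2 v with eqb (π v) (π⁻¹ v) | deg-H v
  ... | true | e = inj₁ e
  ... | false | e = inj₂ e

  deg-1⇒2-cycle : ∀ u → deg H u ≡ 1 → π u ≡ π⁻¹ u
  deg-1⇒2-cycle u d1 with eqb (π u) (π⁻¹ u) in e | deg-H u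
  ... | true | _ = eqb-true _ _ e
  ... | false | d2 rewrite d2 with d1
  ... | ()

  -- The neighbour of a degree-1 vertex lies on the same 2-cycle of π.
  K₂-component : ∀ u v → H u v ≡ true → deg H u ≡ 1 → deg H v ≡ 1
  K₂-component u v h d1 = trans (deg-H v) (cong (λ b → if b then 1 else 2) πv≡π⁻¹v)
    where
     two-cycle = deg-1⇒2-cycle u d1
     π⁻¹u≡v : π⁻¹ u ≡ v
     π⁻¹u≡v with ∨-true _ _ (trans (sym (H-neighbours u v)) h)
     ... | inj₁ e = trans (sym two-cycle) (eqb-true _ _ e)
     ... | inj₂ e = eqb-true _ _ e
     πv≡u : π v ≡ u
     πv≡u = trans (cong π (sym π⁻¹u≡v)) (π∘π⁻¹ u)
     π⁻¹v≡u : π⁻¹ v ≡ u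
     π⁻¹v≡u = injective (π⁻¹ v) u (trans (π∘π⁻¹ v) (trans (sym π⁻¹u≡v) (sym two-cycle)))
     πv≡π⁻¹v : eqb (π v) (π⁻¹ v) ≡ true
     πv≡π⁻¹v = trans (cong₂ eqb πv≡u π⁻¹v≡u) (eqb-refl u)

  factor : OneTwoFactor G
  factor = record { H = H ; Hsym = H-sym ; H⊆G = H⊆G ; deg12 = deg-1-or-2 ; K₂comp = K₂-component }


-- Full rank of some signing gives an edge permutation: the nonzero
-- transversal of the (independent) columns of A(G^σ).
module PermutationFromFullRank where
  open Basics
  open Columns
  open Graphs

  edge-permutation : ∀ n (G : Graph n) → Σ (SignOf G) (λ σ → FullRank n (signedAdj G σ)) → EdgePermutation G
  edge-permutation n G (σ , full) = record
    { perm = proj₁ T ; injective = proj₁ (proj₂ T) ; along-edge = along-edge }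
    where
     A = signedAdj G σ
     independent : Independent n n A
     independent c c-kernel = full c (λ i → trans (Σℚ≡∑ n _) (c-kernel i))
     T = nonzero-transversal n n A independent
     along-edge : ∀ j → adj G j (proj₁ T j) ≡ true
     along-edge j = trans (symm G j _) (nonzero-entry⇒adj G σ _ j (proj₂ (proj₂ T) j))


-- The
-- averaging argument sums over all signings (vectors of vectors of signs)
-- and over all maps Fin n → Fin n (vectors of Fin n).
module Enumeration where
  open Basics

  data Code : Set where
    `Fin : ℕ → Code
    `Sign : Code
    `Vec : Code → ℕ → Code

  El : Code → Set
  El (`Fin m) = Fin m
  El `Sign = Sign
  El (`Vec c n) = Vec (El c) n

  ∑ᵤ : (c : Code) → (El c → ℚ) → ℚ
  ∑ᵤ (`Fin m) f = ∑ m f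
  ∑ᵤ `Sign f = f Sign.+ + f Sign.-
  ∑ᵤ (`Vec c zero) f = f []
  ∑ᵤ (`Vec c (suc n)) f = ∑ᵤ c (λ x → ∑ᵤ (`Vec c n) (λ v → f (x ∷ v)))

  ∑ᵤ-cong : ∀ c {F G : El c → ℚ} → (∀ x → F x ≡ G x) → ∑ᵤ c F ≡ ∑ᵤ c G
  ∑ᵤ-cong (`Fin m) e = ∑-cong m e
  ∑ᵤ-cong `Sign e = cong₂ _+_ (e Sign.+) (e Sign.-)
  ∑ᵤ-cong (`Vec c zero) e = e []
  ∑ᵤ-cong (`Vec c (suc n)) e = ∑ᵤ-cong c (λ x → ∑ᵤ-cong (`Vec c n) (λ v → e (x ∷ v)))

  ∑ᵤ-zero : ∀ c {F : El c → ℚ} → (∀ x → F x ≡ 0ℚ) → ∑ᵤ c F ≡ 0ℚ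
  ∑ᵤ-zero (`Fin m) e = ∑-zero m e
  ∑ᵤ-zero `Sign e = trans (cong₂ _+_ (e Sign.+) (e Sign.-)) (QP.+-identityˡ 0ℚ)
  ∑ᵤ-zero (`Vec c zero) e = e []
  ∑ᵤ-zero (`Vec c (suc n)) e = ∑ᵤ-zero c (λ x → ∑ᵤ-zero (`Vec c n) (λ v → e (x ∷ v)))

  ∑ᵤ-+ : ∀ c (F G : El c → ℚ) → ∑ᵤ c (λ x → F x + G x) ≡ ∑ᵤ c F + ∑ᵤ c G
  ∑ᵤ-+ (`Fin m) F G = ∑-+ m F G
  ∑ᵤ-+ `Sign F G = solve 4 (λ a b c d → (a :+ b) :+ (c :+ d) := (a :+ c) :+ (b :+ d)) refl (F Sign.+) (G Sign.+) (F Sign.-) (G Sign.-)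
  ∑ᵤ-+ (`Vec c zero) F G = refl
  ∑ᵤ-+ (`Vec c (suc n)) F G = trans (∑ᵤ-cong c (λ x → ∑ᵤ-+ (`Vec c n) (λ v → F (x ∷ v)) (λ v → G (x ∷ v)))) (∑ᵤ-+ c _ _)

  ∑ᵤ-*ˡ : ∀ c k (F : El c → ℚ) → ∑ᵤ c (λ x → k * F x) ≡ k * ∑ᵤ c F
  ∑ᵤ-*ˡ (`Fin m) k F = ∑-*ˡ m k F
  ∑ᵤ-*ˡ `Sign k F = sym (QP.*-distribˡ-+ k (F Sign.+) (F Sign.-))
  ∑ᵤ-*ˡ (`Vec c zero) k F = refl
  ∑ᵤ-*ˡ (`Vec c (suc n)) k F = trans (∑ᵤ-cong c (λ x → ∑ᵤ-*ˡ (`Vec c n) k (λ v → F (x ∷ v)))) (∑ᵤ-*ˡ c k _)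

  ∑ᵤ-*ʳ : ∀ c k (F : El c → ℚ) → ∑ᵤ c (λ x → F x * k) ≡ ∑ᵤ c F * k
  ∑ᵤ-*ʳ c k F = trans (∑ᵤ-cong c (λ x → QP.*-comm (F x) k)) (trans (∑ᵤ-*ˡ c k F) (QP.*-comm k (∑ᵤ c F)))

  ∑-∑ᵤ-swap : ∀ m d (F : Fin m → El d → ℚ) → ∑ m (λ x → ∑ᵤ d (F x)) ≡ ∑ᵤ d (λ y → ∑ m (λ x → F x y))
  ∑-∑ᵤ-swap zero d F = sym (∑ᵤ-zero d (λ _ → refl))
  ∑-∑ᵤ-swap (suc m) d F = trans (cong (∑ᵤ d (F zero) +_) (∑-∑ᵤ-swap m d (λ x → F (suc x)))) (sym (∑ᵤ-+ d _ _))

  ∑ᵤ-swap : ∀ c d (F : El c → El d → ℚ) → ∑ᵤ c (λ x → ∑ᵤ d (F x)) ≡ ∑ᵤ d (λ y → ∑ᵤ c (λ x → F x y))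
  ∑ᵤ-swap (`Fin m) d F = ∑-∑ᵤ-swap m d F
  ∑ᵤ-swap `Sign d F = sym (∑ᵤ-+ d (F Sign.+) (F Sign.-))
  ∑ᵤ-swap (`Vec c zero) d F = refl
  ∑ᵤ-swap (`Vec c (suc n)) d F = trans (∑ᵤ-cong c (λ x → ∑ᵤ-swap (`Vec c n) d (λ v → F (x ∷ v)))) (∑ᵤ-swap c d _)

  ∑ᵤ-∏ : ∀ c n (G : Fin n → El c → ℚ) → ∑ᵤ (`Vec c n) (λ v → ∏ n (λ i → G i (lookup v i))) ≡ ∏ n (λ i → ∑ᵤ c (G i))
  ∑ᵤ-∏ c zero G = refl
  ∑ᵤ-∏ c (suc n) G = trans (∑ᵤ-cong c (λ x → ∑ᵤ-*ˡ (`Vec c n) (G zero x) (λ v → ∏ n (λ i → G (suc i) (lookup v i)))))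
    (trans (∑ᵤ-*ʳ c _ (G zero)) (cong (∑ᵤ c (G zero) *_) (∑ᵤ-∏ c n (λ i → G (suc i)))))

  1≰0 : ¬ (1ℚ Q.≤ 0ℚ)
  1≰0 (Q.*≤* (ℤ.+≤+ ()))

  0≤1 : 0ℚ Q.≤ 1ℚ
  0≤1 = Q.*≤* (ℤ.+≤+ z≤n)

  0≤+ : ∀ {x y} → 0ℚ Q.≤ x → 0ℚ Q.≤ y → 0ℚ Q.≤ x + y
  0≤+ {x} {y} a b = subst (λ t → t Q.≤ x + y) (QP.+-identityˡ 0ℚ) (QP.+-mono-≤ a b)

  ≤-addˡ : ∀ {x y z} → 0ℚ Q.≤ z → x Q.≤ y → x Q.≤ z + y
  ≤-addˡ {x} {y} {z} a b = subst (λ t → t Q.≤ z + y) (QP.+-identityˡ x) (QP.+-mono-≤ a b)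

  ≤-addʳ : ∀ {x y z} → x Q.≤ y → 0ℚ Q.≤ z → x Q.≤ y + z
  ≤-addʳ {x} {y} {z} b a = subst (λ t → t Q.≤ y + z) (QP.+-identityʳ x) (QP.+-mono-≤ b a)

  ∑ᵤ-nonneg : ∀ c (I : El c → ℚ) → (∀ x → 0ℚ Q.≤ I x) → 0ℚ Q.≤ ∑ᵤ c I
  ∑ᵤ-nonneg (`Fin zero) I h = QP.≤-refl
  ∑ᵤ-nonneg (`Fin (suc m)) I h = 0≤+ (h zero) (∑ᵤ-nonneg (`Fin m) (λ i → I (suc i)) (λ i → h (suc i)))
  ∑ᵤ-nonneg `Sign I h = 0≤+ (h Sign.+) (h Sign.-)
  ∑ᵤ-nonneg (`Vec c zero) I h = h []
  ∑ᵤ-nonneg (`Vec c (suc n)) I h = ∑ᵤ-nonneg c _ (λ x → ∑ᵤ-nonneg (`Vec c n) _ (λ v → h (x ∷ v)))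

  term≤∑ᵤ : ∀ c (I : El c → ℚ) → (∀ x → 0ℚ Q.≤ I x) → ∀ x0 → I x0 Q.≤ ∑ᵤ c I
  term≤∑ᵤ (`Fin (suc m)) I h zero = ≤-addʳ QP.≤-refl (∑ᵤ-nonneg (`Fin m) _ (λ i → h (suc i)))
  term≤∑ᵤ (`Fin (suc m)) I h (suc k) = ≤-addˡ (h zero) (term≤∑ᵤ (`Fin m) (λ i → I (suc i)) (λ i → h (suc i)) k)
  term≤∑ᵤ `Sign I h Sign.+ = ≤-addʳ QP.≤-refl (h Sign.-)
  term≤∑ᵤ `Sign I h Sign.- = ≤-addˡ (h Sign.+) QP.≤-refl
  term≤∑ᵤ (`Vec c zero) I h [] = QP.≤-refl
  term≤∑ᵤ (`Vec c (suc n)) I h (x ∷ v) = QP.≤-trans (term≤∑ᵤ (`Vec c n) (λ w → I (x ∷ w)) (λ w → h (x ∷ w)) v)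
    (term≤∑ᵤ c (λ y → ∑ᵤ (`Vec c n) (λ w → I (y ∷ w))) (λ y → ∑ᵤ-nonneg (`Vec c n) _ (λ w → h (y ∷ w))) x)

  -- A sum all of whose terms are 0 or κ ≠ 0, at least one being κ, is κ
  -- times a positive quantity, hence nonzero.
  indicator : {P Q : Set} → P ⊎ Q → ℚ
  indicator (inj₁ _) = 0ℚ
  indicator (inj₂ _) = 1ℚ

  ∑ᵤ-two-valued≢0 : ∀ c (F : El c → ℚ) κ → κ ≢ 0ℚ → (h : ∀ x → F x ≡ 0ℚ ⊎ F x ≡ κ) → ∀ x0 → F x0 ≡ κ → ∑ᵤ c F ≢ 0ℚ
  ∑ᵤ-two-valued≢0 c F κ κ≢0 h x₀ Fx₀≡κ ∑≡0 = 1≰0 (subst (1ℚ Q.≤_) ∑I≡0 (subst (Q._≤ ∑ᵤ c I) I-x₀ (term≤∑ᵤ c I I≥0 x₀)))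
    where
     I : El c → ℚ
     I x = indicator (h x)
     F≡κI : ∀ x → F x ≡ κ * I x
     F≡κI x with h x
     ... | inj₁ e = trans e (sym (QP.*-zeroʳ κ))
     ... | inj₂ e = trans e (sym (QP.*-identityʳ κ))
     I≥0 : ∀ x → 0ℚ Q.≤ I x
     I≥0 x with h x
     ... | inj₁ _ = QP.≤-refl
     ... | inj₂ _ = 0≤1
     I-x₀ : I x₀ ≡ 1ℚ
     I-x₀ with h x₀
     ... | inj₁ e = ⊥-elim (κ≢0 (trans (sym Fx₀≡κ) e))
     ... | inj₂ _ = refl
     ∑I≡0 : ∑ᵤ c I ≡ 0ℚ
     ∑I≡0 = cancel-nonzero κ (∑ᵤ c I) κ≢0 (trans (sym (∑ᵤ-*ˡ c κ I)) (trans (sym (∑ᵤ-cong c F≡κI)) ∑≡0))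

  nonzero-term-Vec : ∀ c → (∀ (F : El c → ℚ) → ∑ᵤ c F ≢ 0ℚ → Σ (El c) λ x → F x ≢ 0ℚ) →
    ∀ n (F : Vec (El c) n → ℚ) → ∑ᵤ (`Vec c n) F ≢ 0ℚ → Σ (Vec (El c) n) λ x → F x ≢ 0ℚ
  nonzero-term-Vec c W zero F nz = [] , nz
  nonzero-term-Vec c W (suc n) F nz = proj₁ r1 ∷ proj₁ r2 , proj₂ r2
    where r1 = W (λ x → ∑ᵤ (`Vec c n) (λ v → F (x ∷ v))) nz
          r2 = nonzero-term-Vec c W n (λ v → F (proj₁ r1 ∷ v)) (proj₂ r1)

  nonzero-term-Fin : ∀ m (F : Fin m → ℚ) → ∑ m F ≢ 0ℚ → Σ (Fin m) λ x → F x ≢ 0ℚ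
  nonzero-term-Fin m F nz with search m (λ x → zero-or-nonzero (F x))
  ... | inj₁ r = r
  ... | inj₂ allz = ⊥-elim (nz (∑-zero m allz))

  nonzero-term-Sign : ∀ (F : Sign → ℚ) → F Sign.+ + F Sign.- ≢ 0ℚ → Σ Sign λ x → F x ≢ 0ℚ
  nonzero-term-Sign F nz with zero-or-nonzero (F Sign.+)
  ... | inj₁ a = Sign.+ , a
  ... | inj₂ z with zero-or-nonzero (F Sign.-)
  ...   | inj₁ b = Sign.- , b
  ...   | inj₂ z' = ⊥-elim (nz (trans (cong₂ _+_ z z') (QP.+-identityˡ 0ℚ)))

  nonzero-term : ∀ c (F : El c → ℚ) → ∑ᵤ c F ≢ 0ℚ → Σ (El c) λ x → F x ≢ 0ℚ
  nonzero-term (`Fin m) = nonzero-term-Fin m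
  nonzero-term `Sign = nonzero-term-Sign
  nonzero-term (`Vec c n) = nonzero-term-Vec c (nonzero-term c) n

module Transpositions where
  open Basics
  open Counting
  open Enumeration

  transpose : ∀ {n} → Fin n → Fin n → Fin n → Fin n
  transpose a b i = if eqb i a then b else (if eqb i b then a else i)

  lift : ∀ {n} → (Fin n → Fin n) → Fin (suc n) → Fin (suc n)
  lift σ zero = zero
  lift σ (suc i) = suc (σ i)

  swap₀₁ : ∀ {n} → Fin (suc (suc n)) → Fin (suc (suc n))
  swap₀₁ = transpose zero (suc zero)

  transpose-a : ∀ {n} (a b : Fin n) → transpose a b a ≡ b
  transpose-a a b rewrite eqb-refl a = refl

  transpose-b : ∀ {n} (a b : Fin n) → transpose a b b ≡ a
  transpose-b a b with eqb b a in e
  ... | true = eqb-true b a e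
  ... | false rewrite eqb-refl b = refl

  transpose-other : ∀ {n} (a b i : Fin n) → i ≢ a → i ≢ b → transpose a b i ≡ i
  transpose-other a b i na nb rewrite eqb-false i a na | eqb-false i b nb = refl

  transpose-cases : ∀ {n} (a b i : Fin n) (P : Fin n → Set) →
    (i ≡ a → P i) → (i ≡ b → P i) → (i ≢ a → i ≢ b → P i) → P i
  transpose-cases a b i P h1 h2 h3 with ≡-or-≢ i a
  ... | inj₁ e = h1 e
  ... | inj₂ na with ≡-or-≢ i b
  ...   | inj₁ e = h2 e
  ...   | inj₂ nb = h3 na nb

  transpose-lift : ∀ {n} (a b : Fin n) i → transpose (suc a) (suc b) i ≡ lift (transpose a b) i
  transpose-lift a b zero = refl
  transpose-lift a b (suc j) = transpose-cases a b j (λ j → transpose (suc a) (suc b) (suc j) ≡ suc (transpose a b j))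
    (λ { refl → trans (transpose-a (suc j) (suc b)) (cong suc (sym (transpose-a j b))) })
    (λ { refl → trans (transpose-b (suc a) (suc j)) (cong suc (sym (transpose-b a j))) })
    (λ na nb → trans (transpose-other (suc a) (suc b) (suc j) (λ e → na (FP.suc-injective e)) (λ e → nb (FP.suc-injective e)))
                     (cong suc (sym (transpose-other a b j na nb))))

  transpose-sym : ∀ {n} (a b : Fin n) i → transpose a b i ≡ transpose b a i
  transpose-sym a b i = transpose-cases a b i (λ i → transpose a b i ≡ transpose b a i)
    (λ { refl → trans (transpose-a i b) (sym (transpose-b b i)) })
    (λ { refl → trans (transpose-b a i) (sym (transpose-a i a)) })
    (λ na nb → trans (transpose-other a b i na nb) (sym (transpose-other b a i nb na)))

  transpose-involutive : ∀ {n} (a b : Fin n) i → transpose a b (transpose a b i) ≡ i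
  transpose-involutive a b i = transpose-cases a b i (λ i → transpose a b (transpose a b i) ≡ i)
    (λ { refl → trans (cong (transpose i b) (transpose-a i b)) (transpose-b i b) })
    (λ { refl → trans (cong (transpose a i) (transpose-b a i)) (transpose-a a i) })
    (λ na nb → trans (cong (transpose a b) (transpose-other a b i na nb)) (transpose-other a b i na nb))

  transpose-same : ∀ {n} (a i : Fin n) → transpose a a i ≡ i
  transpose-same a i = transpose-cases a a i (λ i → transpose a a i ≡ i)
    (λ { refl → transpose-a i i }) (λ { refl → transpose-a i i }) (λ na nb → transpose-other a a i na nb)

  transpose-conj : ∀ {n} (c : Fin n) i → transpose zero (suc (suc c)) i ≡ swap₀₁ (transpose (suc zero) (suc (suc c)) (swap₀₁ i))
  transpose-conj c zero = refl
  transpose-conj c (suc zero) = refl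
  transpose-conj c (suc (suc j)) with eqb j c
  ... | true = refl
  ... | false = refl

  transpose-injective : ∀ {n} (a b : Fin n) → IsInjective (transpose a b)
  transpose-injective a b x y e =
    trans (sym (transpose-involutive a b x)) (trans (cong (transpose a b) e) (transpose-involutive a b y))

  -- Every transposition is generated from swap₀₁ by lifting and by
  -- conjugation with swap₀₁, so a property of maps (stable under pointwise
  -- equality) closed under these operations holds for all transpositions.
  module TranspositionInduction (Φ : ∀ {n} → (Fin n → Fin n) → Set)
    (resp : ∀ {n} {σ ρ : Fin n → Fin n} → (∀ i → σ i ≡ ρ i) → Φ σ → Φ ρ)
    (base : ∀ {n} → Φ (swap₀₁ {n}))
    (lft : ∀ {n} {σ : Fin n → Fin n} → Φ σ → Φ (lift σ))
    (conj : ∀ {n} {σ : Fin (suc (suc n)) → Fin (suc (suc n))} → Φ σ → Φ (λ i → swap₀₁ (σ (swap₀₁ i))))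
    where
    from-zero : ∀ n (c : Fin n) → Φ {suc n} (transpose zero (suc c))
    from-zero (suc n) zero = base
    from-zero (suc n) (suc c) =
      resp (λ i → sym (transpose-conj c i)) (conj (resp (λ i → sym (transpose-lift zero (suc c) i)) (lft (from-zero n c))))

    induction : ∀ {n} (a b : Fin n) → a ≢ b → Φ (transpose a b)
    induction zero zero ne = ⊥-elim (ne refl)
    induction {suc n} zero (suc b) ne = from-zero n b
    induction {suc n} (suc a) zero ne = resp (λ i → transpose-sym zero (suc a) i) (from-zero n a)
    induction (suc a) (suc b) ne = resp (λ i → sym (transpose-lift a b i)) (lft (induction a b (λ e → ne (cong suc e))))

  permute : ∀ {A : Set} {n} → Vec A n → (Fin n → Fin n) → Vec A n
  permute v σ = tabulate (λ i → lookup v (σ i))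

  permute-cong : ∀ {A : Set} {n} (v : Vec A n) {σ ρ : Fin n → Fin n} → (∀ i → σ i ≡ ρ i) → permute v σ ≡ permute v ρ
  permute-cong v e = VP.tabulate-cong (λ i → cong (lookup v) (e i))

  permute-∘ : ∀ {A : Set} {n} (v : Vec A n) (σ ρ : Fin n → Fin n) → permute (permute v σ) ρ ≡ permute v (λ i → σ (ρ i))
  permute-∘ v σ ρ = VP.tabulate-cong (λ i → VP.lookup∘tabulate (λ j → lookup v (σ j)) (ρ i))

  permute-swap₀₁ : ∀ {A : Set} {n} (x y : A) (v : Vec A n) → permute (x ∷ y ∷ v) swap₀₁ ≡ y ∷ x ∷ v
  permute-swap₀₁ x y v = cong (λ t → y ∷ x ∷ t) (VP.tabulate∘lookup v)

  -- orient a b is the sign of b − a (zero if a = b).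
  orient : ∀ {m} → Fin m → Fin m → ℚ
  orient zero zero = 0ℚ
  orient zero (suc _) = 1ℚ
  orient (suc _) zero = - 1ℚ
  orient (suc a) (suc b) = orient a b

  orient-anti : ∀ {m} (a b : Fin m) → orient b a ≡ - orient a b
  orient-anti zero zero = refl
  orient-anti zero (suc b) = refl
  orient-anti (suc a) zero = refl
  orient-anti (suc a) (suc b) = orient-anti a b

  orients : ∀ {m n} → Fin m → Vec (Fin m) n → ℚ
  orients x [] = 1ℚ
  orients x (y ∷ v) = orient x y * orients x v

  -- ε v = ∏_{i<j} orient vᵢ vⱼ: the sign of v viewed as a map Fin n → Fin m,
  -- and 0 when v has a repeated entry.
  ε : ∀ {m n} → Vec (Fin m) n → ℚ
  ε [] = 1ℚ
  ε (x ∷ v) = orients x v * ε v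

  orients-∏ : ∀ {m n} (x : Fin m) (v : Vec (Fin m) n) → orients x v ≡ ∏ n (λ i → orient x (lookup v i))
  orients-∏ x [] = refl
  orients-∏ x (y ∷ v) = cong (orient x y *_) (orients-∏ x v)

  orient-self : ∀ {m} (a : Fin m) → orient a a ≡ 0ℚ
  orient-self zero = refl
  orient-self (suc a) = orient-self a

  orient≢0 : ∀ {m} (a b : Fin m) → a ≢ b → orient a b ≢ 0ℚ
  orient≢0 zero zero ne = ⊥-elim (ne refl)
  orient≢0 zero (suc b) ne ()
  orient≢0 (suc a) zero ne ()
  orient≢0 (suc a) (suc b) ne = orient≢0 a b (λ e → ne (cong suc e))

  orients≢0 : ∀ {m n} (x : Fin m) (v : Vec (Fin m) n) → (∀ j → x ≢ lookup v j) → orients x v ≢ 0ℚ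
  orients≢0 x [] h = 1≢0
  orients≢0 x (y ∷ v) h = *-nonzero _ _ (orient≢0 x y (h zero)) (orients≢0 x v (λ j → h (suc j)))

  orients≡0 : ∀ {m n} (x : Fin m) (v : Vec (Fin m) n) j → x ≡ lookup v j → orients x v ≡ 0ℚ
  orients≡0 x (y ∷ v) zero e = trans (cong (_* orients x v) (trans (cong (orient x) (sym e)) (orient-self x))) (QP.*-zeroˡ (orients x v))
  orients≡0 x (y ∷ v) (suc j) e = trans (cong (orient x y *_) (orients≡0 x v j e)) (QP.*-zeroʳ (orient x y))

  injective⇒ε≢0 : ∀ {m n} (v : Vec (Fin m) n) → IsInjective (lookup v) → ε v ≢ 0ℚ
  injective⇒ε≢0 [] h = 1≢0
  injective⇒ε≢0 (x ∷ v) h = *-nonzero _ _ (orients≢0 x v (λ j e → FP.0≢1+n (h zero (suc j) e)))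
                                            (injective⇒ε≢0 v (λ a b e → FP.suc-injective (h (suc a) (suc b) e)))

  ε≢0⇒injective : ∀ {m n} (v : Vec (Fin m) n) → ε v ≢ 0ℚ → IsInjective (lookup v)
  ε≢0⇒injective (x ∷ v) nz zero zero e = refl
  ε≢0⇒injective (x ∷ v) nz zero (suc j) e = ⊥-elim (*≢0ˡ (orients x v) (ε v) nz (orients≡0 x v j e))
  ε≢0⇒injective (x ∷ v) nz (suc i) zero e = ⊥-elim (*≢0ˡ (orients x v) (ε v) nz (orients≡0 x v i (sym e)))
  ε≢0⇒injective (x ∷ v) nz (suc i) (suc j) e = cong suc (ε≢0⇒injective v (*≢0ʳ (orients x v) (ε v) nz) i j e)

  ∏-Invariant : ∀ {n} → (Fin n → Fin n) → Set
  ∏-Invariant {n} σ = ∀ h → ∏ n (λ i → h (σ i)) ≡ ∏ n h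

  ∑-Invariant : ∀ {n} → (Fin n → Fin n) → Set
  ∑-Invariant {n} σ = ∀ c (F : Vec (El c) n → ℚ) → ∑ᵤ (`Vec c n) (λ v → F (permute v σ)) ≡ ∑ᵤ (`Vec c n) F

  ε-Flips : ∀ {n} → (Fin n → Fin n) → Set
  ε-Flips {n} σ = ∀ m (v : Vec (Fin m) n) → ε (permute v σ) ≡ - ε v

  SwapLike : ∀ {n} → (Fin n → Fin n) → Set
  SwapLike σ = ∏-Invariant σ × ∑-Invariant σ × ε-Flips σ

  ∏-invariant-swap₀₁ : ∀ {n} → ∏-Invariant (swap₀₁ {n})
  ∏-invariant-swap₀₁ {n} h =
    solve 3 (λ a b c → b :* (a :* c) := a :* (b :* c)) refl (h zero) (h (suc zero)) (∏ n (λ i → h (suc (suc i))))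

  ∑-invariant-swap₀₁ : ∀ {n} → ∑-Invariant (swap₀₁ {n})
  ∑-invariant-swap₀₁ {n} c F =
    trans (∑ᵤ-cong c (λ x → ∑ᵤ-cong c (λ y → ∑ᵤ-cong (`Vec c n) (λ v → cong F (permute-swap₀₁ x y v)))))
          (∑ᵤ-swap c c (λ x y → ∑ᵤ (`Vec c n) (λ v → F (y ∷ x ∷ v))))

  ε-flips-swap₀₁ : ∀ {n} → ε-Flips (swap₀₁ {n})
  ε-flips-swap₀₁ m (x ∷ y ∷ v) = trans (cong ε (permute-swap₀₁ x y v))
    (trans (cong (λ t → t * orients y v * (orients x v * ε v)) (orient-anti x y))
     (solve 4 (λ a b c d → (:- a) :* b :* (c :* d) := :- (a :* c :* (b :* d))) refl (orient x y) (orients y v) (orients x v) (ε v)))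

  swapLike-resp : ∀ {n} {σ ρ : Fin n → Fin n} → (∀ i → σ i ≡ ρ i) → SwapLike σ → SwapLike ρ
  swapLike-resp {n} e (p , s , f) =
    (λ h → trans (∏-cong n (λ i → cong h (sym (e i)))) (p h)) ,
    (λ c F → trans (∑ᵤ-cong (`Vec c n) (λ v → cong F (permute-cong v (λ i → sym (e i))))) (s c F)) ,
    (λ m v → trans (cong ε (permute-cong v (λ i → sym (e i)))) (f m v))

  -- Under a lift the head of v keeps its place; the orientations of the head
  -- against the tail are merely permuted.
  swapLike-lift : ∀ {n} {σ : Fin n → Fin n} → SwapLike σ → SwapLike (lift σ)
  swapLike-lift {n} {σ} (p , s , f) =
    (λ h → cong (h zero *_) (p (λ i → h (suc i)))) ,
    (λ c F → ∑ᵤ-cong c (λ x → s c (λ v → F (x ∷ v)))) ,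
    (λ { m (x ∷ v) → trans (cong₂ _*_ (head-orients x v) (f m v))
                           (solve 2 (λ a b → a :* (:- b) := :- (a :* b)) refl (orients x v) (ε v)) })
    where
     head-orients : ∀ {m} (x : Fin m) v → orients x (permute v σ) ≡ orients x v
     head-orients x v = begin
       orients x (permute v σ)                     ≡⟨ orients-∏ x (permute v σ) ⟩
       ∏ n (λ i → orient x (lookup (permute v σ) i)) ≡⟨ ∏-cong n (λ i → cong (orient x) (VP.lookup∘tabulate (λ j → lookup v (σ j)) i)) ⟩
       ∏ n (λ i → orient x (lookup v (σ i)))       ≡⟨ p (λ i → orient x (lookup v i)) ⟩
       ∏ n (λ i → orient x (lookup v i))           ≡⟨ sym (orients-∏ x v) ⟩
       orients x v                                 ∎
       where open ≡-Reasoning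

  swapLike-conj : ∀ {n} {σ : Fin (suc (suc n)) → Fin (suc (suc n))} → SwapLike σ → SwapLike (λ i → swap₀₁ (σ (swap₀₁ i)))
  swapLike-conj {n} {σ} (p , s , f) =
    (λ h → trans (∏-invariant-swap₀₁ (λ j → h (swap₀₁ (σ j)))) (trans (p (λ j → h (swap₀₁ j))) (∏-invariant-swap₀₁ h))) ,
    (λ c F → trans (∑ᵤ-cong (`Vec c (suc (suc n))) (λ v → cong F (sym (unfold v))))
       (trans (∑-invariant-swap₀₁ c (λ w → F (permute (permute w σ) swap₀₁)))
              (trans (s c (λ w → F (permute w swap₀₁))) (∑-invariant-swap₀₁ c F)))) ,
    (λ m v → trans (cong ε (sym (unfold v)))
       (trans (ε-flips-swap₀₁ m (permute (permute v swap₀₁) σ))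
       (trans (cong -_ (f m (permute v swap₀₁)))
       (trans (cong (λ t → - - t) (ε-flips-swap₀₁ m v))
              (solve 1 (λ a → :- (:- (:- a)) := :- a) refl (ε v))))))
    where
     unfold : ∀ {A : Set} (v : Vec A (suc (suc n))) →
       permute (permute (permute v swap₀₁) σ) swap₀₁ ≡ permute v (λ i → swap₀₁ (σ (swap₀₁ i)))
     unfold v = trans (permute-∘ (permute v swap₀₁) σ swap₀₁) (permute-∘ v swap₀₁ (λ i → σ (swap₀₁ i)))

  transpose-swapLike : ∀ {n} (a b : Fin n) → a ≢ b → SwapLike (transpose a b)
  transpose-swapLike = TranspositionInduction.induction SwapLike swapLike-resp
    (∏-invariant-swap₀₁ , ∑-invariant-swap₀₁ , ε-flips-swap₀₁)
    (λ {n} {σ} p → swapLike-lift {n} {σ} p) (λ {n} {σ} p → swapLike-conj {n} {σ} p)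


-- Determinants by the Leibniz formula, and the only property of them we
-- need: a matrix with nonzero determinant has linearly independent rows.
module Determinants where
  open Basics
  open Counting
  open Columns using (Matrix)
  open Enumeration
  open Transpositions

  -- det M = ∑_v ε(v) ∏ᵢ M i (v i), summed over all maps v : Fin n → Fin n
  -- (those that are not permutations have ε v = 0).
  det : ∀ n → Matrix n n → ℚ
  det n M = ∑ᵤ (`Vec (`Fin n) n) (λ v → ε v * ∏ n (λ i → M i (lookup v i)))

  det-cong : ∀ n {M N : Matrix n n} → (∀ i j → M i j ≡ N i j) → det n M ≡ det n N
  det-cong n e = ∑ᵤ-cong (`Vec (`Fin n) n) (λ v → cong (ε v *_) (∏-cong n (λ i → e i _)))

  self-negating⇒0 : ∀ x → x ≡ - x → x ≡ 0ℚ
  self-negating⇒0 x e = cancel-nonzero (1ℚ + 1ℚ) x (λ ()) (begin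
    (1ℚ + 1ℚ) * x ≡⟨ solve 1 (λ x → (con 1ℚ :+ con 1ℚ) :* x := x :+ x) refl x ⟩
    x + x         ≡⟨ cong (x +_) e ⟩
    x + - x       ≡⟨ QP.+-inverseʳ x ⟩
    0ℚ            ∎)
    where open ≡-Reasoning

  -- The determinant is alternating: reindexing the sum by the transposition
  -- τ of two equal rows a, b negates every term, so det M = - det M.
  det-equal-rows : ∀ n (M : Matrix n n) a b → a ≢ b → (∀ j → M a j ≡ M b j) → det n M ≡ 0ℚ
  det-equal-rows n M a b a≢b Ma≡Mb =
    self-negating⇒0 (det n M) (trans negated (solve 1 (λ d → (:- con 1ℚ) :* d := :- d) refl (det n M)))
    where
     τ = transpose a b
     open Σ (transpose-swapLike a b a≢b) renaming (proj₁ to ∏-inv; proj₂ to rest)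
     open Σ rest renaming (proj₁ to ∑-inv; proj₂ to ε-flip)
     term : Vec (Fin n) n → ℚ
     term v = ε v * ∏ n (λ i → M i (lookup v i))
     rows-τ : ∀ i j → M (τ i) j ≡ M i j
     rows-τ i j = transpose-cases a b i (λ i → M (τ i) j ≡ M i j)
       (λ { refl → trans (cong (λ t → M t j) (transpose-a i b)) (sym (Ma≡Mb j)) })
       (λ { refl → trans (cong (λ t → M t j) (transpose-b a i)) (Ma≡Mb j) })
       (λ na nb → cong (λ t → M t j) (transpose-other a b i na nb))
     ∏-τ : ∀ v → ∏ n (λ i → M i (lookup (permute v τ) i)) ≡ ∏ n (λ i → M i (lookup v i))
     ∏-τ v = begin
       ∏ n (λ i → M i (lookup (permute v τ) i))
         ≡⟨ ∏-cong n (λ i → cong₂ M (sym (transpose-involutive a b i)) (VP.lookup∘tabulate (λ j → lookup v (τ j)) i)) ⟩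
       ∏ n (λ i → M (τ (τ i)) (lookup v (τ i))) ≡⟨ ∏-inv (λ j → M (τ j) (lookup v j)) ⟩
       ∏ n (λ i → M (τ i) (lookup v i))         ≡⟨ ∏-cong n (λ i → rows-τ i (lookup v i)) ⟩
       ∏ n (λ i → M i (lookup v i))             ∎
       where open ≡-Reasoning
     term-τ : ∀ v → term (permute v τ) ≡ - 1ℚ * term v
     term-τ v = trans (cong₂ _*_ (ε-flip n v) (∏-τ v)) (solve 2 (λ e q → (:- e) :* q := (:- con 1ℚ) :* (e :* q)) refl (ε v) _)
     negated : ∑ᵤ (`Vec (`Fin n) n) term ≡ - 1ℚ * ∑ᵤ (`Vec (`Fin n) n) term
     negated = trans (sym (∑-inv (`Fin n) term)) (trans (∑ᵤ-cong (`Vec (`Fin n) n) term-τ) (∑ᵤ-*ˡ (`Vec (`Fin n) n) (- 1ℚ) term))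

  replaceRow : ∀ {n} → Matrix n n → Fin n → (Fin n → ℚ) → Matrix n n
  replaceRow M k r i j = if eqb i k then r j else M i j

  ∏-split-at : ∀ n (k : Fin n) (x g : Fin n → ℚ) →
    ∏ n (λ i → if eqb i k then x i else g i) ≡ x k * ∏ n (λ i → if eqb i k then 1ℚ else g i)
  ∏-split-at (suc n) zero x g = cong (x zero *_) (sym (QP.*-identityˡ _))
  ∏-split-at (suc n) (suc k) x g = trans (cong (g zero *_) (∏-split-at n k (λ i → x (suc i)) (λ i → g (suc i))))
    (solve 3 (λ a b c → a :* (b :* c) := b :* (a :* c)) refl (g zero) (x (suc k)) _)

  off-row-product : ∀ {n} → Matrix n n → Fin n → Vec (Fin n) n → ℚ
  off-row-product {n} M k v = ∏ n (λ i → if eqb i k then 1ℚ else M i (lookup v i))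

  det-replaceRow : ∀ n (M : Matrix n n) k r →
    det n (replaceRow M k r) ≡ ∑ᵤ (`Vec (`Fin n) n) (λ v → ε v * (r (lookup v k) * off-row-product M k v))
  det-replaceRow n M k r =
    ∑ᵤ-cong (`Vec (`Fin n) n) (λ v → cong (ε v *_) (∏-split-at n k (λ i → r (lookup v i)) (λ i → M i (lookup v i))))

  det-linear-row : ∀ n (M : Matrix n n) k (R : Fin n → Fin n → ℚ) (c : Fin n → ℚ) →
    det n (replaceRow M k (λ j → ∑ n (λ l → c l * R l j))) ≡ ∑ n (λ l → c l * det n (replaceRow M k (R l)))
  det-linear-row n M k R c = begin
    det n (replaceRow M k (λ j → ∑ n (λ l → c l * R l j)))         ≡⟨ det-replaceRow n M k (λ j → ∑ n (λ l → c l * R l j)) ⟩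
    ∑ᵤ Vs (λ v → ε v * (∑ n (λ l → c l * R l (lookup v k)) * Q v)) ≡⟨ ∑ᵤ-cong Vs distribute ⟩
    ∑ᵤ Vs (λ v → ∑ n (λ l → c l * (ε v * (R l (lookup v k) * Q v)))) ≡⟨ ∑ᵤ-swap Vs (`Fin n) _ ⟩
    ∑ n (λ l → ∑ᵤ Vs (λ v → c l * (ε v * (R l (lookup v k) * Q v))))
      ≡⟨ ∑-cong n (λ l → trans (∑ᵤ-*ˡ Vs (c l) _) (cong (c l *_) (sym (det-replaceRow n M k (R l))))) ⟩
    ∑ n (λ l → c l * det n (replaceRow M k (R l)))                  ∎
    where
     open ≡-Reasoning
     Vs = `Vec (`Fin n) n
     Q = off-row-product M k
     distribute : ∀ v → ε v * (∑ n (λ l → c l * R l (lookup v k)) * Q v) ≡ ∑ n (λ l → c l * (ε v * (R l (lookup v k) * Q v)))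
     distribute v = sym (trans
       (∑-cong n (λ l → solve 4 (λ cl e r q → cl :* (e :* (r :* q)) := (e :* q) :* (cl :* r)) refl (c l) (ε v) (R l (lookup v k)) (Q v)))
       (trans (∑-*ˡ n (ε v * Q v) (λ l → c l * R l (lookup v k)))
              (solve 3 (λ e q s → (e :* q) :* s := e :* (s :* q)) refl (ε v) (Q v) _)))

  det-zero-row : ∀ n (M : Matrix n n) k → det n (replaceRow M k (λ _ → 0ℚ)) ≡ 0ℚ
  det-zero-row n M k = trans (det-replaceRow n M k (λ _ → 0ℚ))
    (∑ᵤ-zero (`Vec (`Fin n) n) (λ v → trans (cong (ε v *_) (QP.*-zeroˡ (off-row-product M k v))) (QP.*-zeroʳ (ε v))))

  -- If ∑ₗ cₗ (row l) = 0 then replacing row k by this combination gives, by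
  -- linearity and alternation, both cₖ det M and det of a zero row.
  det≢0⇒rows-independent : ∀ n (A : Matrix n n) → det n A ≢ 0ℚ →
    ∀ c → (∀ j → ∑ n (λ l → c l * A l j) ≡ 0ℚ) → ∀ k → c k ≡ 0ℚ
  det≢0⇒rows-independent n A det≢0 c rows-vanish k =
    cancel-nonzero (det n A) (c k) det≢0 (trans (QP.*-comm (det n A) (c k)) ck·det≡0)
    where
     open ≡-Reasoning
     other-rows : ∀ l → l ≢ k → c l * det n (replaceRow A k (A l)) ≡ 0ℚ
     other-rows l l≢k = trans (cong (c l *_) (det-equal-rows n (replaceRow A k (A l)) k l (λ e → l≢k (sym e))
        (λ j → trans (cong (λ b → if b then A l j else A k j) (eqb-refl k))
                     (sym (cong (λ b → if b then A l j else A l j) (eqb-false l k l≢k))))))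
        (QP.*-zeroʳ (c l))
     replace-by-itself : ∀ i j → replaceRow A k (A k) i j ≡ A i j
     replace-by-itself i j with eqb i k in e
     ... | true = cong (λ t → A t j) (sym (eqb-true i k e))
     ... | false = refl
     ck·det≡0 : c k * det n A ≡ 0ℚ
     ck·det≡0 = begin
       c k * det n A                                            ≡⟨ cong (c k *_) (sym (det-cong n replace-by-itself)) ⟩
       c k * det n (replaceRow A k (A k))                       ≡⟨ sym (∑-single n (λ l → c l * det n (replaceRow A k (A l))) k other-rows) ⟩
       ∑ n (λ l → c l * det n (replaceRow A k (A l)))           ≡⟨ sym (det-linear-row n A k A c) ⟩
       det n (replaceRow A k (λ j → ∑ n (λ l → c l * A l j)))
         ≡⟨ det-cong n (λ i j → cong (λ t → if eqb i k then t else A i j) (rows-vanish j)) ⟩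
       det n (replaceRow A k (λ _ → 0ℚ))                        ≡⟨ det-zero-row n A k ⟩
       0ℚ                                                       ∎


-- The sign of a permutation is determined, up to the parity bookkeeping of
-- fixed points, by its "pattern" {uv | exactly one of f u = v, f v = u}:
-- the pattern records the cycles of length ≥ 3 (up to orientation) and
-- forgets 2-cycles and fixed points.  The proof removes vertex 0 and
-- recurses; the pattern of the contracted permutation depends only on the
-- pattern of the original one.
module SignByPattern where
  open Basics
  open Counting
  open Enumeration
  open Transpositions
  open import Algebra.Properties.CommutativeSemigroup NP.+-commutativeSemigroup using (x∙yz≈y∙xz)

  -- The sign of a map f : Fin n → Fin n (0 if f is not injective).
  sign : ∀ {n} → (Fin n → Fin n) → ℚ
  sign f = ε (tabulate f)

  sign-cong : ∀ {n} {f g : Fin n → Fin n} → (∀ i → f i ≡ g i) → sign f ≡ sign g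
  sign-cong e = cong ε (VP.tabulate-cong e)

  sign-transpose : ∀ {n} (f : Fin n → Fin n) a b → a ≢ b → sign (λ i → f (transpose a b i)) ≡ - sign f
  sign-transpose {n} f a b ne =
    trans (cong ε (VP.tabulate-cong (λ i → sym (VP.lookup∘tabulate f (transpose a b i)))))
          (proj₂ (proj₂ (transpose-swapLike a b ne)) n (tabulate f))

  orients-zero-suc : ∀ {n m} (g : Fin n → Fin m) → orients zero (tabulate (λ i → suc (g i))) ≡ 1ℚ
  orients-zero-suc {zero} g = refl
  orients-zero-suc {suc n} g = trans (cong (1ℚ *_) (orients-zero-suc (λ i → g (suc i)))) (QP.*-identityˡ 1ℚ)

  orients-suc : ∀ {n m} (x : Fin m) (g : Fin n → Fin m) → orients (suc x) (tabulate (λ i → suc (g i))) ≡ orients x (tabulate g)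
  orients-suc {zero} x g = refl
  orients-suc {suc n} x g = cong (orient x (g zero) *_) (orients-suc x (λ i → g (suc i)))

  ε-suc : ∀ {n m} (g : Fin n → Fin m) → ε (tabulate (λ i → suc (g i))) ≡ ε (tabulate g)
  ε-suc {zero} g = refl
  ε-suc {suc n} g = cong₂ _*_ (orients-suc (g zero) (λ i → g (suc i))) (ε-suc (λ i → g (suc i)))

  sign-restrict : ∀ {n} (h : Fin (suc n) → Fin (suc n)) (r : Fin n → Fin n) →
    h zero ≡ zero → (∀ i → suc (r i) ≡ h (suc i)) → sign h ≡ sign r
  sign-restrict h r h0 hs = begin
    orients (h zero) (tabulate (λ i → h (suc i))) * ε (tabulate (λ i → h (suc i)))
      ≡⟨ cong₂ (λ x t → orients x t * ε t) h0 (VP.tabulate-cong (λ i → sym (hs i))) ⟩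
    orients zero (tabulate (λ i → suc (r i))) * ε (tabulate (λ i → suc (r i))) ≡⟨ cong₂ _*_ (orients-zero-suc r) (ε-suc r) ⟩
    1ℚ * ε (tabulate r)                                                     ≡⟨ QP.*-identityˡ _ ⟩
    sign r                                                                  ∎
    where open ≡-Reasoning

  HasPattern : ∀ {n} → (Fin n → Fin n → Bool) → (Fin n → Fin n) → Set
  HasPattern {n} T f = ∀ u v → T u v ≡ (eqb (f u) v xor eqb (f v) u)

  fixedPoints : ∀ {n} → (Fin n → Fin n) → ℕ
  fixedPoints {n} f = count n (λ i → eqb (f i) i)

  -- Removing vertex 0 from a long cycle … w' → 0 → w … joins w' to w.
  contractPattern : ∀ {n} → (Fin (suc n) → Fin (suc n) → Bool) → Fin n → Fin n → Bool
  contractPattern T a b = T (suc a) (suc b) xor (T zero (suc a) ∧ T zero (suc b) ∧ not (eqb a b))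

  count-split-at : ∀ n (b c : Fin n → Bool) p → (∀ i → i ≢ p → b i ≡ c i) → b p ≡ false → count n c ≡ bit (c p) ℕ.+ count n b
  count-split-at (suc n) b c zero h bp =
    cong₂ ℕ._+_ refl (trans (count-cong n (λ i → sym (h (suc i) (λ ())))) (cong (λ t → bit t ℕ.+ count n (λ i → b (suc i))) (sym bp)))
  count-split-at (suc n) b c (suc p) h bp =
    trans (cong₂ ℕ._+_ (cong bit (sym (h zero (λ ())))) (count-split-at n _ _ p (λ i ne → h (suc i) (λ e → ne (FP.suc-injective e))) bp))
          (x∙yz≈y∙xz (bit (b zero)) (bit (c (suc p))) (count n (λ i → b (suc i))))

  -- Boolean identities for the cases of contracted-pattern (below), with
  -- a = [w = X], b = [w = Y] and the remaining pattern bits p, q, e.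
  neither-is-w′ : ∀ a b e → (a ≡ true → b ≡ e) → (a xor false) ∧ (b xor false) ∧ not e ≡ false
  neither-is-w′ false b e h = refl
  neither-is-w′ true false e h = refl
  neither-is-w′ true true true h = refl
  neither-is-w′ true true false h with h refl
  ... | ()

  X-is-w′ : ∀ a b q → (b ≡ true → a ≡ false) → q xor ((a xor true) ∧ (b xor false) ∧ not false) ≡ b xor q
  X-is-w′ a false q h rewrite BP.∧-zeroʳ (a xor true) = BP.xor-identityʳ q
  X-is-w′ a true q h rewrite h refl = BP.xor-comm q true

  Y-is-w′ : ∀ a b p → (a ≡ true → b ≡ false) → (p xor false) xor ((a xor false) ∧ (b xor true) ∧ not false) ≡ p xor a
  Y-is-w′ false b p h rewrite BP.xor-identityʳ p = BP.xor-identityʳ p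
  Y-is-w′ true b p h rewrite h refl | BP.xor-identityʳ p = refl

  -- The pattern of f ∘ (0 w') at X, Y ≠ 0, where f w' = 0 and w = f 0,
  -- equals the contracted pattern; one Boolean identity for each of the
  -- cases according as X, Y equal w'.
  contracted-pattern : ∀ {N} (f : Fin N → Fin N) (w w' X Y : Fin N) → eqb (f w') X ≡ false → eqb (f w') Y ≡ false →
     (eqb (f X) Y xor eqb (f Y) X) xor ((eqb w X xor eqb w' X) ∧ (eqb w Y xor eqb w' Y) ∧ not (eqb X Y))
     ≡ (eqb (if eqb X w' then w else f X) Y xor eqb (if eqb Y w' then w else f Y) X)
  contracted-pattern f w w' X Y hX hY with ≡-or-≢ X w' | ≡-or-≢ Y w'
  ... | inj₂ nX | inj₂ nY
    rewrite eqb-false X w' nX | eqb-false Y w' nY | eqb-false w' X (λ e → nX (sym e)) | eqb-false w' Y (λ e → nY (sym e))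
    = trans (cong ((eqb (f X) Y xor eqb (f Y) X) xor_)
                  (neither-is-w′ (eqb w X) (eqb w Y) (eqb X Y) (λ e → cong (λ t → eqb t Y) (eqb-true w X e))))
            (BP.xor-identityʳ _)
  ... | inj₁ refl | inj₂ nY rewrite eqb-refl X | eqb-false Y X nY | eqb-false X Y (λ e → nY (sym e)) | hY
    = X-is-w′ (eqb w X) (eqb w Y) (eqb (f Y) X) (λ e → eqb-false w X (λ wX → nY (trans (sym (eqb-true w Y e)) wX)))
  ... | inj₂ nX | inj₁ refl rewrite eqb-false X Y nX | eqb-refl Y | eqb-false Y X (λ e → nX (sym e)) | hX
    = Y-is-w′ (eqb w X) (eqb w Y) (eqb (f X) Y) (λ e → trans (cong (λ t → eqb t Y) (eqb-true w X e)) (eqb-false X Y nX))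
  ... | inj₁ refl | inj₁ refl rewrite eqb-refl w' | BP.xor-same (eqb (f w') w') | BP.xor-same (eqb w w')
    = cong (false xor_) (trans (cong ((eqb w w' xor true) ∧_) (BP.∧-zeroʳ (eqb w w' xor true))) (BP.∧-zeroʳ (eqb w w' xor true)))

  -- How removing vertex 0 changes sign and fixed points, according as 0 is
  -- a fixed point, on a 2-cycle, or on a longer cycle of f; the pattern
  -- row of 0 tells the first two cases from the third.
  data Contraction {n} (T : Fin (suc n) → Fin (suc n) → Bool) (f : Fin (suc n) → Fin (suc n)) (r : Fin n → Fin n) : Set where
    fixed-zero : sign f ≡ sign r → fixedPoints f ≡ suc (fixedPoints r) → (∀ a → T zero a ≡ false) → Contraction T f r
    two-cycle-zero : sign f ≡ - sign r → fixedPoints r ≡ suc (fixedPoints f) → (∀ a → T zero a ≡ false) → Contraction T f r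
    long-cycle-zero : sign f ≡ - sign r → fixedPoints r ≡ fixedPoints f → (Σ (Fin (suc n)) λ a → T zero a ≡ true) → Contraction T f r

  record Reduced {n} (T : Fin (suc n) → Fin (suc n) → Bool) (f : Fin (suc n) → Fin (suc n)) : Set where
    field
      r : Fin n → Fin n
      r-injective : IsInjective r
      r-pattern : HasPattern (contractPattern T) r
      kind : Contraction T f r

  -- Contract the injection f at vertex 0: with w = f 0 and w' = f⁻¹ 0,
  -- the map f₁ = f ∘ (0 w') fixes 0, and r is f₁ restricted to 1..n.
  module Contract {n} (T : Fin (suc n) → Fin (suc n) → Bool) (f : Fin (suc n) → Fin (suc n))
                  (f-inj : IsInjective f) (f-pattern : HasPattern T f) where
    w : Fin (suc n)
    w = f zero
    w' : Fin (suc n)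
    w' = proj₁ (injective⇒surjective f f-inj zero)
    fw'≡0 : f w' ≡ zero
    fw'≡0 = proj₂ (injective⇒surjective f f-inj zero)
    f₁ : Fin (suc n) → Fin (suc n)
    f₁ i = f (transpose zero w' i)
    f₁-inj : IsInjective f₁
    f₁-inj x y e = transpose-injective zero w' x y (f-inj _ _ e)
    f₁0≡0 : f₁ zero ≡ zero
    f₁0≡0 = trans (cong f (transpose-a zero w')) fw'≡0
    f₁suc≢0 : ∀ i → f₁ (suc i) ≢ zero
    f₁suc≢0 i e with f₁-inj zero (suc i) (trans f₁0≡0 (sym e))
    ... | ()
    r : Fin n → Fin n
    r i = punchOut (λ e → f₁suc≢0 i (sym e))
    suc-r : ∀ i → suc (r i) ≡ f₁ (suc i)
    suc-r i = FP.punchIn-punchOut (λ e → f₁suc≢0 i (sym e))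
    r-injective : IsInjective r
    r-injective a b e = FP.suc-injective (f₁-inj (suc a) (suc b) (trans (sym (suc-r a)) (trans (cong suc e) (suc-r b))))
    sign-f₁ : sign f₁ ≡ sign r
    sign-f₁ = sign-restrict f₁ r f₁0≡0 suc-r

    preimage-of-0 : ∀ a → eqb (f a) zero ≡ eqb w' a
    preimage-of-0 a with ≡-or-≢ a w'
    ... | inj₁ refl = trans (cong (λ t → eqb t zero) fw'≡0) (sym (eqb-refl a))
    ... | inj₂ ne = trans (eqb-false (f a) zero (λ e → ne (f-inj a w' (trans e (sym fw'≡0))))) (sym (eqb-false w' a (λ e → ne (sym e))))
    pattern-row-0 : ∀ a → T zero a ≡ (eqb w a xor eqb w' a)
    pattern-row-0 a = trans (f-pattern zero a) (cong (eqb w a xor_) (preimage-of-0 a))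
    f₁-value : ∀ x → x ≢ zero → f₁ x ≡ (if eqb x w' then w else f x)
    f₁-value x nz rewrite eqb-false x zero nz with eqb x w'
    ... | true = refl
    ... | false = refl

    r-pattern : HasPattern (contractPattern T) r
    r-pattern a b = begin
      contractPattern T a b
        ≡⟨ cong₂ (λ u v → u xor (v ∧ T zero (suc b) ∧ not (eqb a b))) (f-pattern (suc a) (suc b)) (pattern-row-0 (suc a)) ⟩
      (eqb (f (suc a)) (suc b) xor eqb (f (suc b)) (suc a)) xor ((eqb w (suc a) xor eqb w' (suc a)) ∧ T zero (suc b) ∧ not (eqb a b))
        ≡⟨ cong (λ v → (eqb (f (suc a)) (suc b) xor eqb (f (suc b)) (suc a)) xor ((eqb w (suc a) xor eqb w' (suc a)) ∧ v ∧ not (eqb a b)))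
                (pattern-row-0 (suc b)) ⟩
      (eqb (f (suc a)) (suc b) xor eqb (f (suc b)) (suc a))
        xor ((eqb w (suc a) xor eqb w' (suc a)) ∧ (eqb w (suc b) xor eqb w' (suc b)) ∧ not (eqb (suc a) (suc b)))
        ≡⟨ contracted-pattern f w w' (suc a) (suc b) (cong (λ t → eqb t (suc a)) fw'≡0) (cong (λ t → eqb t (suc b)) fw'≡0) ⟩
      eqb (if eqb (suc a) w' then w else f (suc a)) (suc b) xor eqb (if eqb (suc b) w' then w else f (suc b)) (suc a)
        ≡⟨ sym (cong₂ (λ u v → eqb u (suc b) xor eqb v (suc a))
                      (trans (suc-r a) (f₁-value (suc a) (λ ()))) (trans (suc-r b) (f₁-value (suc b) (λ ())))) ⟩
      eqb (r a) b xor eqb (r b) a ∎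
      where open ≡-Reasoning

    fixed-tail : ℕ
    fixed-tail = count n (λ i → eqb (f (suc i)) (suc i))
    fixedPoints-r : fixedPoints r ≡ count n (λ i → eqb (f₁ (suc i)) (suc i))
    fixedPoints-r = count-cong n (λ i → cong (λ t → eqb t (suc i)) (suc-r i))

    -- 0 is a fixed point: f₁ = f.
    kind-fixed : w ≡ zero → Contraction T f r
    kind-fixed w≡0 = fixed-zero sign-f fixed (λ a → trans (pattern-row-0 a) (trans (cong (λ t → eqb t a xor eqb w' a) (trans w≡0 (sym w'≡0))) (BP.xor-same (eqb w' a))))
      where
       w'≡0 : w' ≡ zero
       w'≡0 = f-inj w' zero (trans fw'≡0 (sym w≡0))
       f₁≡f : ∀ i → f₁ i ≡ f i
       f₁≡f i = cong f (trans (cong (λ t → transpose zero t i) w'≡0) (transpose-same zero i))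
       sign-f : sign f ≡ sign r
       sign-f = trans (sign-cong (λ i → sym (f₁≡f i))) sign-f₁
       fixed : fixedPoints f ≡ suc (fixedPoints r)
       fixed = trans (cong (λ t → bit (eqb t zero) ℕ.+ fixed-tail) w≡0)
                     (cong suc (sym (trans fixedPoints-r (count-cong n (λ i → cong (λ t → eqb t (suc i)) (f₁≡f (suc i)))))))

    module Moved (w≢0 : w ≢ zero) where
      w'≢0 : w' ≢ zero
      w'≢0 e = w≢0 (trans (cong f (sym e)) fw'≡0)
      sign-f : sign f ≡ - sign r
      sign-f = trans (solve 1 (λ x → x := :- (:- x)) refl (sign f))
                     (cong -_ (trans (sym (sign-transpose f zero w' (λ e → w'≢0 (sym e)))) sign-f₁))
      p : Fin n
      p = punchOut (λ e → w'≢0 (sym e))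
      suc-p : suc p ≡ w'
      suc-p = FP.punchIn-punchOut (λ e → w'≢0 (sym e))
      agree-off-p : ∀ i → i ≢ p → eqb (f (suc i)) (suc i) ≡ eqb (f₁ (suc i)) (suc i)
      agree-off-p i ne = cong (λ t → eqb t (suc i)) (sym (trans (f₁-value (suc i) (λ ()))
        (cong (λ b → if b then w else f (suc i)) (eqb-false (suc i) w' (λ e → ne (FP.suc-injective (trans e (sym suc-p))))))))
      f-at-p : eqb (f (suc p)) (suc p) ≡ false
      f-at-p = cong (λ t → eqb t (suc p)) (trans (cong f suc-p) fw'≡0)
      f₁-at-p : eqb (f₁ (suc p)) (suc p) ≡ eqb w w'
      f₁-at-p = trans (cong (λ t → eqb (f₁ t) t) suc-p)
        (cong (λ t → eqb t w') (trans (f₁-value w' w'≢0) (cong (λ b → if b then w else f w') (eqb-refl w'))))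
      fixed-f : fixedPoints f ≡ fixed-tail
      fixed-f = cong (λ t → bit t ℕ.+ fixed-tail) (eqb-false w zero w≢0)
      fixed-r : fixedPoints r ≡ bit (eqb w w') ℕ.+ fixedPoints f
      fixed-r = trans fixedPoints-r (trans (count-split-at n _ _ p agree-off-p f-at-p) (cong₂ ℕ._+_ (cong bit f₁-at-p) (sym fixed-f)))


    -- 0 is moved: f₁ differs from f by a transposition, and the vertex w'
    -- becomes fixed exactly when w = w' (0 lies on a 2-cycle).
    kind-moved : w ≢ zero → Contraction T f r
    kind-moved w≢0 with ≡-or-≢ w w'
    ... | inj₁ w≡w' = two-cycle-zero sign-f (trans fixed-r (cong (λ t → bit t ℕ.+ fixedPoints f) (trans (cong (eqb w) (sym w≡w')) (eqb-refl w))))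
                        (λ a → trans (pattern-row-0 a) (trans (cong (λ t → eqb t a xor eqb w' a) w≡w') (BP.xor-same (eqb w' a))))
      where open Moved w≢0
    ... | inj₂ w≢w' = long-cycle-zero sign-f (trans fixed-r (cong (λ t → bit t ℕ.+ fixedPoints f) (eqb-false w w' w≢w')))
                        (w , trans (pattern-row-0 w) (cong₂ _xor_ (eqb-refl w) (eqb-false w' w (λ e → w≢w' (sym e)))))
      where open Moved w≢0

    kind : Contraction T f r
    kind = [ kind-fixed , kind-moved ]′ (≡-or-≢ w zero)

  contract : ∀ {n} (T : Fin (suc n) → Fin (suc n) → Bool) (f : Fin (suc n) → Fin (suc n)) → IsInjective f → HasPattern T f → Reduced T f
  contract T f f-inj f-pat = record
    { r = Contract.r T f f-inj f-pat ; r-injective = Contract.r-injective T f f-inj f-pat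
    ; r-pattern = Contract.r-pattern T f f-inj f-pat ; kind = Contract.kind T f f-inj f-pat }

  minus-one^ : ℕ → ℚ
  minus-one^ zero = 1ℚ
  minus-one^ (suc k) = - minus-one^ k

  negate-both : ∀ x y u v → x * y ≡ u * v → (- x) * y ≡ (- u) * v
  negate-both x y u v e = trans (solve 2 (λ x y → (:- x) :* y := :- (x :* y)) refl x y)
                                (trans (cong -_ e) (solve 2 (λ u v → :- (u :* v) := (:- u) :* v) refl u v))

  +-2*-suc : ∀ x a → x ℕ.+ 2 ℕ.* suc a ≡ suc (suc (x ℕ.+ 2 ℕ.* a))
  +-2*-suc x a = trans (cong (x ℕ.+_) (NP.*-suc 2 a)) (x∙yz≈y∙xz x 2 (2 ℕ.* a))

  module Combine {n} {T : Fin (suc n) → Fin (suc n) → Bool} {f g : Fin (suc n) → Fin (suc n)} {rf rg : Fin n → Fin n}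
    (a b : ℕ) (e : fixedPoints f ℕ.+ 2 ℕ.* a ≡ fixedPoints g ℕ.+ 2 ℕ.* b)
    (IH : ∀ a b → fixedPoints rf ℕ.+ 2 ℕ.* a ≡ fixedPoints rg ℕ.+ 2 ℕ.* b → sign rf * minus-one^ b ≡ sign rg * minus-one^ a) where
    -- Both contractions are of the same kind as far as the pattern row of
    -- 0 can tell; a 2-cycle against a fixed point shifts a or b by one.
    compare : Contraction T f rf → Contraction T g rg → sign f * minus-one^ b ≡ sign g * minus-one^ a
    compare (fixed-zero ef xf _) (fixed-zero eg xg _) =
      trans (cong (_* minus-one^ b) ef) (trans (IH a b e') (cong (_* minus-one^ a) (sym eg)))
      where e' = NP.suc-injective (trans (sym (cong (ℕ._+ 2 ℕ.* a) xf)) (trans e (cong (ℕ._+ 2 ℕ.* b) xg)))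
    compare (fixed-zero ef xf _) (two-cycle-zero eg xg _) =
      trans (cong (_* minus-one^ b) ef)
      (trans (IH (suc a) b e')
      (trans (solve 2 (λ x y → x :* (:- y) := (:- x) :* y) refl (sign rg) (minus-one^ a)) (cong (_* minus-one^ a) (sym eg))))
      where e' = trans (+-2*-suc (fixedPoints rf) a)
                       (trans (cong suc (trans (cong (ℕ._+ 2 ℕ.* a) (sym xf)) e)) (cong (ℕ._+ 2 ℕ.* b) (sym xg)))
    compare (two-cycle-zero ef xf _) (fixed-zero eg xg _) =
      trans (cong (_* minus-one^ b) ef)
      (trans (trans (solve 2 (λ x y → (:- x) :* y := x :* (:- y)) refl (sign rf) (minus-one^ b)) (IH a (suc b) e'))
             (cong (_* minus-one^ a) (sym eg)))
      where e' = trans (cong (ℕ._+ 2 ℕ.* a) xf)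
                       (trans (cong suc e) (trans (cong (λ t → suc (t ℕ.+ 2 ℕ.* b)) xg) (sym (+-2*-suc (fixedPoints rg) b))))
    compare (two-cycle-zero ef xf _) (two-cycle-zero eg xg _) =
      trans (cong (_* minus-one^ b) ef)
      (trans (negate-both (sign rf) (minus-one^ b) (sign rg) (minus-one^ a) (IH a b e')) (cong (_* minus-one^ a) (sym eg)))
      where e' = trans (cong (ℕ._+ 2 ℕ.* a) xf) (trans (cong suc e) (cong (ℕ._+ 2 ℕ.* b) (sym xg)))
    compare (long-cycle-zero ef xf _) (long-cycle-zero eg xg _) =
      trans (cong (_* minus-one^ b) ef)
      (trans (negate-both (sign rf) (minus-one^ b) (sign rg) (minus-one^ a) (IH a b e')) (cong (_* minus-one^ a) (sym eg)))
      where e' = trans (cong (ℕ._+ 2 ℕ.* a) xf) (trans e (cong (ℕ._+ 2 ℕ.* b) (sym xg)))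
    compare (fixed-zero _ _ tf) (long-cycle-zero _ _ (x , tx)) = ⊥-elim (false≢true (trans (sym (tf x)) tx))
    compare (two-cycle-zero _ _ tf) (long-cycle-zero _ _ (x , tx)) = ⊥-elim (false≢true (trans (sym (tf x)) tx))
    compare (long-cycle-zero _ _ (x , tx)) (fixed-zero _ _ tg) = ⊥-elim (false≢true (trans (sym (tg x)) tx))
    compare (long-cycle-zero _ _ (x , tx)) (two-cycle-zero _ _ tg) = ⊥-elim (false≢true (trans (sym (tg x)) tx))


  -- Two injections with the same pattern have the same sign once the
  -- difference of their fixed-point counts (always even) is accounted for:
  -- a 2-cycle of one corresponds to two fixed points of the other.
  sign-determined-by-pattern : ∀ n (T : Fin n → Fin n → Bool) (f g : Fin n → Fin n) →
    IsInjective f → IsInjective g → HasPattern T f → HasPattern T g →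
    ∀ a b → fixedPoints f ℕ.+ 2 ℕ.* a ≡ fixedPoints g ℕ.+ 2 ℕ.* b → sign f * minus-one^ b ≡ sign g * minus-one^ a
  sign-determined-by-pattern zero T f g _ _ _ _ a b e = cong (1ℚ *_) (cong minus-one^ (sym (NP.*-cancelˡ-≡ a b 2 e)))
  sign-determined-by-pattern (suc n) T f g f-inj g-inj f-pat g-pat a b e =
    Combine.compare a b e IH (Reduced.kind RF) (Reduced.kind RG)
    where
     RF = contract T f f-inj f-pat
     RG = contract T g g-inj g-pat
     rf = Reduced.r RF
     rg = Reduced.r RG
     IH : ∀ a b → fixedPoints rf ℕ.+ 2 ℕ.* a ≡ fixedPoints rg ℕ.+ 2 ℕ.* b → sign rf * minus-one^ b ≡ sign rg * minus-one^ a
     IH = sign-determined-by-pattern n (contractPattern T) rf rg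
            (Reduced.r-injective RF) (Reduced.r-injective RG) (Reduced.r-pattern RF) (Reduced.r-pattern RG)


module SignProducts where
  open Basics
  open Counting

  signℚ-* : ∀ a b → signℚ (a Sg.* b) ≡ signℚ a * signℚ b
  signℚ-* Sign.+ Sign.+ = refl
  signℚ-* Sign.+ Sign.- = refl
  signℚ-* Sign.- Sign.+ = refl
  signℚ-* Sign.- Sign.- = refl

  signℚ² : ∀ a → signℚ a * signℚ a ≡ 1ℚ
  signℚ² Sign.+ = refl
  signℚ² Sign.- = refl

  ∏-select : ∀ n (a : Fin n) (h : Fin n → ℚ) → ∏ n (λ v → if eqb a v then h v else 1ℚ) ≡ h a
  ∏-select (suc n) zero h = trans (cong (h zero *_) (∏-one n (λ _ → refl))) (QP.*-identityʳ (h zero))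
  ∏-select (suc n) (suc a) h = trans (QP.*-identityˡ _) (∏-select n a (λ v → h (suc v)))

  -- For x² = 1, exponents of x only matter modulo 2.
  if-xor-product : ∀ (x : ℚ) → x * x ≡ 1ℚ → ∀ t p q →
    (if t then x else 1ℚ) * ((if p then x else 1ℚ) * (if q then x else 1ℚ)) ≡ (if (t xor (p xor q)) then x else 1ℚ)
  if-xor-product x xx true true true = trans (cong (x *_) xx) (QP.*-identityʳ x)
  if-xor-product x xx true true false = trans (cong (x *_) (QP.*-identityʳ x)) xx
  if-xor-product x xx true false true = trans (cong (x *_) (QP.*-identityˡ x)) xx
  if-xor-product x xx true false false = trans (cong (x *_) (QP.*-identityˡ 1ℚ)) (QP.*-identityʳ x)
  if-xor-product x xx false true true = trans (QP.*-identityˡ _) xx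
  if-xor-product x xx false true false = trans (QP.*-identityˡ _) (QP.*-identityʳ x)
  if-xor-product x xx false false true = trans (QP.*-identityˡ _) (QP.*-identityˡ x)
  if-xor-product x xx false false false = refl

  ∑-signs : ∀ e → (if e then signℚ Sign.+ else 1ℚ) + (if e then signℚ Sign.- else 1ℚ) ≡ (if e then 0ℚ else 1ℚ + 1ℚ)
  ∑-signs true = QP.+-inverseʳ 1ℚ
  ∑-signs false = refl

  ∏-*-three : ∀ m (f g h : Fin m → ℚ) → ∏ m f * (∏ m g * ∏ m h) ≡ ∏ m (λ i → f i * (g i * h i))
  ∏-*-three m f g h = sym (trans (∏-* m f (λ i → g i * h i)) (cong (∏ m f *_) (∏-* m g h)))


-- Give
-- each ordered pair (u,v) an independent sign s(u,v) and sign the edge uv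
-- by s(u,v)s(v,u).  Weight det A(Gˢ) by χ(s) = ∏_{(u,v) ∈ T} s(u,v), T the
-- pattern of π, and sum over all s.  Expanding det, a map w contributes
-- ε(w) ∑ₛ ∏ s(u,v)^{[T uv] + [w u = v] + [w v = u]}, which vanishes unless
-- w runs along edges with the pattern T, and then equals sign π · 2^{n²}
-- (sign-determined-by-pattern).  As π contributes, the total is nonzero, so
-- some signing has det ≠ 0 and hence full rank.
module NonsingularSigning {n} (G : Graph n) (P : Graphs.EdgePermutation G) where
  open Basics
  open Counting
  open Enumeration
  open Transpositions
  open Determinants
  open SignByPattern
  open SignProducts
  open Graphs using (Σℚ≡∑; if-false-0; module EdgePermutation)
  open EdgePermutation P renaming (perm to π; injective to π-injective; along-edge to π-along-edge)
  open ≡-Reasoning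

  T : Fin n → Fin n → Bool
  T u v = eqb (π u) v xor eqb (π v) u

  Signings : Code
  Signings = `Vec (`Vec `Sign n) n

  Maps : Code
  Maps = `Vec (`Fin n) n

  half : El Signings → Fin n → Fin n → Sign
  half s u v = lookup (lookup s u) v

  signing : El Signings → SignOf G
  signing s = record { sgn = λ u v → half s u v Sg.* half s v u ; sgnSym = λ u v _ → SgP.*-comm (half s u v) (half s v u) }

  A : El Signings → Fin n → Fin n → ℚ
  A s = signedAdj G (signing s)

  A-sym : ∀ s i j → A s i j ≡ A s j i
  A-sym s i j = cong₂ (λ b x → if b then x else 0ℚ) (symm G i j) (cong signℚ (SgP.*-comm (half s i j) (half s j i)))

  χ : El Signings → ℚ
  χ s = ∏ n (λ u → ∏ n (λ v → if T u v then signℚ (half s u v) else 1ℚ))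

  term : El Signings → El Maps → ℚ
  term s w = ∏ n (λ i → A s i (lookup w i))

  averaged : El Maps → ℚ
  averaged w = ∑ᵤ Signings (λ s → χ s * term s w)

  Total : ℚ
  Total = ∑ᵤ Signings (λ s → χ s * det n (A s))

  Total-by-maps : Total ≡ ∑ᵤ Maps (λ w → ε w * averaged w)
  Total-by-maps = begin
    ∑ᵤ Signings (λ s → χ s * ∑ᵤ Maps (λ w → ε w * term s w))
      ≡⟨ ∑ᵤ-cong Signings (λ s → sym (∑ᵤ-*ˡ Maps (χ s) (λ w → ε w * term s w))) ⟩
    ∑ᵤ Signings (λ s → ∑ᵤ Maps (λ w → χ s * (ε w * term s w)))
      ≡⟨ ∑ᵤ-swap Signings Maps (λ s w → χ s * (ε w * term s w)) ⟩
    ∑ᵤ Maps (λ w → ∑ᵤ Signings (λ s → χ s * (ε w * term s w)))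
      ≡⟨ ∑ᵤ-cong Maps (λ w → trans (∑ᵤ-cong Signings (λ s → solve 3 (λ a b c → a :* (b :* c) := b :* (a :* c)) refl (χ s) (ε w) (term s w)))
                                   (∑ᵤ-*ˡ Signings (ε w) (λ s → χ s * term s w))) ⟩
    ∑ᵤ Maps (λ w → ε w * averaged w) ∎

  -- The parity of the exponent of s(u,v) in χ(s) · term s w.
  mismatch : El Maps → Fin n → Fin n → Bool
  mismatch w u v = T u v xor (eqb (lookup w u) v xor eqb (lookup w v) u)

  AlongEdges : El Maps → Set
  AlongEdges w = ∀ i → adj G i (lookup w i) ≡ true

  χ·term : ∀ w → AlongEdges w → ∀ s → χ s * term s w ≡ ∏ n (λ u → ∏ n (λ v → if mismatch w u v then signℚ (half s u v) else 1ℚ))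
  χ·term w along s = begin
    χ s * term s w
      ≡⟨ cong (χ s *_) (∏-cong n (λ i → trans (cong (λ b → if b then signℚ (half s i (g i) Sg.* half s (g i) i) else 0ℚ) (along i))
                                              (signℚ-* (half s i (g i)) (half s (g i) i)))) ⟩
    χ s * ∏ n (λ i → signℚ (half s i (g i)) * signℚ (half s (g i) i))                  ≡⟨ cong (χ s *_) (∏-* n _ _) ⟩
    χ s * (∏ n (λ i → signℚ (half s i (g i))) * ∏ n (λ i → signℚ (half s (g i) i)))    ≡⟨ cong₂ (λ x y → χ s * (x * y)) forward backward ⟩
    χ s * (∏ n (λ u → ∏ n (λ v → x^[ eqb (g u) v ] u v)) * ∏ n (λ u → ∏ n (λ v → x^[ eqb (g v) u ] u v))) ≡⟨ ∏-*-three n _ _ _ ⟩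
    ∏ n (λ u → ∏ n (λ v → x^[ T u v ] u v) * (∏ n (λ v → x^[ eqb (g u) v ] u v) * ∏ n (λ v → x^[ eqb (g v) u ] u v)))
      ≡⟨ ∏-cong n (λ u → trans (∏-*-three n _ _ _)
                               (∏-cong n (λ v → if-xor-product (signℚ (half s u v)) (signℚ² (half s u v)) (T u v) (eqb (g u) v) (eqb (g v) u)))) ⟩
    ∏ n (λ u → ∏ n (λ v → x^[ mismatch w u v ] u v)) ∎
    where
     g = lookup w
     x^[_] : Bool → Fin n → Fin n → ℚ
     x^[ b ] u v = if b then signℚ (half s u v) else 1ℚ
     forward : ∏ n (λ i → signℚ (half s i (g i))) ≡ ∏ n (λ u → ∏ n (λ v → x^[ eqb (g u) v ] u v))
     forward = ∏-cong n (λ u → sym (∏-select n (g u) (λ v → signℚ (half s u v))))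
     backward : ∏ n (λ i → signℚ (half s (g i) i)) ≡ ∏ n (λ u → ∏ n (λ v → x^[ eqb (g v) u ] u v))
     backward = trans (∏-cong n (λ i → sym (∏-select n (g i) (λ v → signℚ (half s v i)))))
                      (∏-swap n n (λ i v → if eqb (g i) v then signℚ (half s v i) else 1ℚ))

  -- Averaging kills every odd exponent: each pair contributes 0 or 2.
  averaged-value : ∀ w → AlongEdges w → averaged w ≡ ∏ n (λ u → ∏ n (λ v → if mismatch w u v then 0ℚ else 1ℚ + 1ℚ))
  averaged-value w along = begin
    averaged w ≡⟨ ∑ᵤ-cong Signings (χ·term w along) ⟩
    ∑ᵤ Signings (λ s → ∏ n (λ u → ∏ n (λ v → if mismatch w u v then signℚ (half s u v) else 1ℚ)))
      ≡⟨ ∑ᵤ-∏ (`Vec `Sign n) n (λ u row → ∏ n (λ v → if mismatch w u v then signℚ (lookup row v) else 1ℚ)) ⟩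
    ∏ n (λ u → ∑ᵤ (`Vec `Sign n) (λ row → ∏ n (λ v → if mismatch w u v then signℚ (lookup row v) else 1ℚ)))
      ≡⟨ ∏-cong n (λ u → ∑ᵤ-∏ `Sign n (λ v x → if mismatch w u v then signℚ x else 1ℚ)) ⟩
    ∏ n (λ u → ∏ n (λ v → (if mismatch w u v then signℚ Sign.+ else 1ℚ) + (if mismatch w u v then signℚ Sign.- else 1ℚ)))
      ≡⟨ ∏-cong n (λ u → ∏-cong n (λ v → ∑-signs (mismatch w u v))) ⟩
    ∏ n (λ u → ∏ n (λ v → if mismatch w u v then 0ℚ else 1ℚ + 1ℚ)) ∎

  κ : ℚ
  κ = sign π * ∏ n (λ _ → ∏ n (λ _ → 1ℚ + 1ℚ))

  -- G has no loops, so maps along edges have no fixed points.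
  no-fixed-points : ∀ (g : Fin n → Fin n) → (∀ i → adj G i (g i) ≡ true) → fixedPoints g ≡ 0
  no-fixed-points g along = trans (count-cong n (λ i → eqb-false (g i) i
    (λ eq → false≢true (trans (sym (irrefl G i)) (trans (cong (adj G i) (sym eq)) (along i)))))) (count-false n)

  surviving-term : ∀ w → AlongEdges w → (∀ u v → mismatch w u v ≡ false) → ε w ≢ 0ℚ → ε w * averaged w ≡ κ
  surviving-term w along no-mismatch ε≢0 = cong₂ _*_ ε≡sign-π averaged≡
    where
     g = lookup w
     averaged≡ : averaged w ≡ ∏ n (λ _ → ∏ n (λ _ → 1ℚ + 1ℚ))
     averaged≡ = trans (averaged-value w along)
       (∏-cong n (λ u → ∏-cong n (λ v → cong (λ b → if b then 0ℚ else 1ℚ + 1ℚ) (no-mismatch u v))))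
     same-sign : sign g * 1ℚ ≡ sign π * 1ℚ
     same-sign = sign-determined-by-pattern n T g π (ε≢0⇒injective w ε≢0) π-injective
       (λ u v → xor≡false⇒≡ _ _ (no-mismatch u v)) (λ u v → refl) 0 0
       (trans (cong (ℕ._+ 0) (no-fixed-points g along)) (sym (cong (ℕ._+ 0) (no-fixed-points π π-along-edge))))
     ε≡sign-π : ε w ≡ sign π
     ε≡sign-π = trans (sym (cong ε (VP.tabulate∘lookup w)))
                      (trans (sym (QP.*-identityʳ (sign g))) (trans same-sign (QP.*-identityʳ (sign π))))

  term-0-or-κ : ∀ w → ε w * averaged w ≡ 0ℚ ⊎ ε w * averaged w ≡ κ
  term-0-or-κ w with search n (λ i → Sum.swap (true-or-false (adj G i (lookup w i))))
  ... | inj₁ (i , non-edge) = inj₁ (trans (cong (ε w *_) averaged≡0) (QP.*-zeroʳ (ε w)))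
    where averaged≡0 : averaged w ≡ 0ℚ
          averaged≡0 = ∑ᵤ-zero Signings (λ s → trans (cong (χ s *_) (∏-zero n _ i (if-false-0 (adj G i (lookup w i)) _ non-edge)))
                                                    (QP.*-zeroʳ (χ s)))
  ... | inj₂ along with some-true-or-all-false (mismatch w)
  ...   | inj₁ (u , v , odd) = inj₁ (trans (cong (ε w *_) (trans (averaged-value w along)
                                 (∏-zero n _ u (∏-zero n _ v (cong (λ b → if b then 0ℚ else 1ℚ + 1ℚ) odd))))) (QP.*-zeroʳ (ε w)))
  ...   | inj₂ no-mismatch with zero-or-nonzero (ε w)
  ...     | inj₂ ε≡0 = inj₁ (trans (cong (_* averaged w) ε≡0) (QP.*-zeroˡ (averaged w)))
  ...     | inj₁ ε≢0 = inj₂ (surviving-term w along no-mismatch ε≢0)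

  w₀ : El Maps
  w₀ = tabulate π

  lookup-w₀ : ∀ i → lookup w₀ i ≡ π i
  lookup-w₀ i = VP.lookup∘tabulate π i

  ε-w₀≢0 : ε w₀ ≢ 0ℚ
  ε-w₀≢0 = injective⇒ε≢0 w₀ (λ a b eq → π-injective a b (trans (sym (lookup-w₀ a)) (trans eq (lookup-w₀ b))))

  w₀-survives : ε w₀ * averaged w₀ ≡ κ
  w₀-survives = surviving-term w₀ (λ i → trans (cong (adj G i) (lookup-w₀ i)) (π-along-edge i))
    (λ u v → trans (cong₂ (λ a b → T u v xor (eqb a v xor eqb b u)) (lookup-w₀ u) (lookup-w₀ v)) (BP.xor-same (T u v)))
    ε-w₀≢0

  Total≢0 : Total ≢ 0ℚ
  Total≢0 Total≡0 = ∑ᵤ-two-valued≢0 Maps (λ w → ε w * averaged w) κ κ≢0 term-0-or-κ w₀ w₀-survives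
                      (trans (sym Total-by-maps) Total≡0)
    where κ≢0 = *-nonzero _ _ ε-w₀≢0 (∏-nonzero n _ (λ _ → ∏-nonzero n _ (λ _ → λ ())))

  -- Some signing s has χ(s) det A(Gˢ) ≠ 0; A(Gˢ) is symmetric, so its
  -- columns are its rows, which are independent.
  nonsingular : Σ (SignOf G) (λ σ → FullRank n (signedAdj G σ))
  nonsingular = signing s , full-rank
    where
     witness = nonzero-term Signings (λ s → χ s * det n (A s)) Total≢0
     s = proj₁ witness
     det≢0 : det n (A s) ≢ 0ℚ
     det≢0 = *≢0ʳ (χ s) (det n (A s)) (proj₂ witness)
     full-rank : FullRank n (A s)
     full-rank c kernel = det≢0⇒rows-independent n (A s) det≢0 c (λ j →
       trans (∑-cong n (λ l → trans (QP.*-comm (c l) (A s l j)) (cong (_* c l) (A-sym s l j))))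
             (trans (sym (Σℚ≡∑ n _)) (kernel j)))


-- A {1,2}-factor yields an edge permutation: orient every cycle and turn
-- every K₂ into a 2-cycle.  We prove this for the slightly more general
-- "partial factors" H, in which every vertex is isolated, lies in a K₂, or
-- has degree 2: there is an injection f with f u = u or f u an H-neighbour
-- of u, traversing every edge of H.  By induction on the number of
-- vertices, according to the shape of H at vertex 0: if 0 is isolated, fix
-- it; if 0 lies in a K₂ {0, p}, make p isolated, recurse and close the
-- 2-cycle (0 p); if 0 has neighbours w ≠ w', delete 0 and join w to w',
-- recurse, and put 0 back on the edge ww' in the direction it is walked.
module PermutationFromFactor where
  open Basics
  open Counting
  open Transpositions using (lift)
  open Graphs using (deg≡count; EdgePermutation)

  BoolMatrix : ℕ → Set
  BoolMatrix n = Fin n → Fin n → Bool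

  Isolated : ∀ {n} → BoolMatrix n → Fin n → Set
  Isolated H u = ∀ v → H u v ≡ false

  K₂Partner : ∀ {n} → BoolMatrix n → Fin n → Fin n → Set
  K₂Partner H u p = H u p ≡ true × (∀ v → H u v ≡ true → v ≡ p) × (∀ v → H p v ≡ true → v ≡ u)

  TwoNeighbours : ∀ {n} → BoolMatrix n → Fin n → Fin n → Fin n → Set
  TwoNeighbours H u p q = p ≢ q × H u p ≡ true × H u q ≡ true × (∀ v → H u v ≡ true → v ≡ p ⊎ v ≡ q)

  LocalShape : ∀ {n} → BoolMatrix n → Fin n → Set
  LocalShape H u = Isolated H u ⊎ (Σ _ λ p → K₂Partner H u p) ⊎ (Σ _ λ p → Σ _ λ q → TwoNeighbours H u p q)

  IsFactor : ∀ {n} → BoolMatrix n → Set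
  IsFactor H = (∀ u v → H u v ≡ H v u) × (∀ u → H u u ≡ false) × (∀ u → LocalShape H u)

  record Orientation {n} (H : BoolMatrix n) : Set where
    constructor mkOrientation
    field
      walk : Fin n → Fin n
      walk-injective : IsInjective walk
      walk-step : ∀ u → walk u ≡ u ⊎ H u (walk u) ≡ true
      walk-covers : ∀ u v → H u v ≡ true → walk u ≡ v ⊎ walk v ≡ u
  open Orientation

  orientation-cong : ∀ {n} {H K : BoolMatrix n} → (∀ a b → H a b ≡ K a b) → Orientation H → Orientation K
  orientation-cong {H = H} {K} e (mkOrientation f f-inj step covers) =
    mkOrientation f f-inj step' (λ u v h → covers u v (trans (e u v) h))
    where step' : ∀ u → f u ≡ u ⊎ K u (f u) ≡ true
          step' u with step u
          ... | inj₁ x = inj₁ x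
          ... | inj₂ h = inj₂ (trans (sym (e u (f u))) h)

  insert-after : ∀ {m} → (Fin m → Fin m) → Fin m → Fin (suc m) → Fin (suc m)
  insert-after g x zero = suc (g x)
  insert-after g x (suc i) = if eqb i x then zero else suc (g i)

  insert-after-x : ∀ {m} (g : Fin m → Fin m) x → insert-after g x (suc x) ≡ zero
  insert-after-x g x rewrite eqb-refl x = refl

  insert-after-other : ∀ {m} (g : Fin m → Fin m) x i → i ≢ x → insert-after g x (suc i) ≡ suc (g i)
  insert-after-other g x i ne rewrite eqb-false i x ne = refl

  insert-after-injective : ∀ {m} (g : Fin m → Fin m) x → IsInjective g → IsInjective (insert-after g x)
  insert-after-injective g x gi zero zero e = refl
  insert-after-injective g x gi zero (suc j) e with ≡-or-≢ j x
  ... | inj₁ refl = ⊥-elim (FP.0≢1+n (sym (trans e (insert-after-x g j))))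
  ... | inj₂ ne = ⊥-elim (ne (sym (gi x j (FP.suc-injective (trans e (insert-after-other g x j ne))))))
  insert-after-injective g x gi (suc i) zero e with ≡-or-≢ i x
  ... | inj₁ refl = ⊥-elim (FP.0≢1+n (trans (sym (insert-after-x g i)) e))
  ... | inj₂ ne = ⊥-elim (ne (gi i x (FP.suc-injective (trans (sym (insert-after-other g x i ne)) e))))
  insert-after-injective g x gi (suc i) (suc j) e with ≡-or-≢ i x | ≡-or-≢ j x
  ... | inj₁ refl | inj₁ refl = refl
  ... | inj₁ refl | inj₂ nj = ⊥-elim (FP.0≢1+n (trans (sym (insert-after-x g i)) (trans e (insert-after-other g i j nj))))
  ... | inj₂ ni | inj₁ refl = ⊥-elim (FP.0≢1+n (sym (trans (sym (insert-after-other g j i ni)) (trans e (insert-after-x g j)))))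
  ... | inj₂ ni | inj₂ nj = cong suc (gi i j (FP.suc-injective (trans (sym (insert-after-other g x i ni)) (trans e (insert-after-other g x j nj)))))

  lift-injective : ∀ {m} (g : Fin m → Fin m) → IsInjective g → IsInjective (lift g)
  lift-injective g gi zero zero e = refl
  lift-injective g gi zero (suc j) ()
  lift-injective g gi (suc i) zero ()
  lift-injective g gi (suc i) (suc j) e = cong suc (gi i j (FP.suc-injective e))

  shape-restrict : ∀ {m} (H : BoolMatrix (suc m)) (H' : BoolMatrix m) a →
    (∀ b → H' a b ≡ H (suc a) (suc b)) → H (suc a) zero ≡ false →
    (∀ c → K₂Partner H (suc a) (suc c) → ∀ b → H' c b ≡ H (suc c) (suc b)) →
    LocalShape H (suc a) → LocalShape H' a
  shape-restrict H H' a ra h0 pr (inj₁ iso) = inj₁ (λ b → trans (ra b) (iso (suc b)))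
  shape-restrict H H' a ra h0 pr (inj₂ (inj₁ (zero , hp , _ , _))) = ⊥-elim (false≢true (trans (sym h0) hp))
  shape-restrict H H' a ra h0 pr (inj₂ (inj₁ (suc c , hp , u1 , u2))) =
    inj₂ (inj₁ (c , trans (ra c) hp , (λ v hv → FP.suc-injective (u1 (suc v) (trans (sym (ra v)) hv))) ,
                (λ v hv → FP.suc-injective (u2 (suc v) (trans (sym (pr c (hp , u1 , u2) v)) hv)))))
  shape-restrict H H' a ra h0 pr (inj₂ (inj₂ (zero , q , ne , hp , hq , u))) = ⊥-elim (false≢true (trans (sym h0) hp))
  shape-restrict H H' a ra h0 pr (inj₂ (inj₂ (suc p , zero , ne , hp , hq , u))) = ⊥-elim (false≢true (trans (sym h0) hq))
  shape-restrict H H' a ra h0 pr (inj₂ (inj₂ (suc p , suc q , ne , hp , hq , u))) =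
    inj₂ (inj₂ (p , q , (λ e → ne (cong suc e)) , trans (ra p) hp , trans (ra q) hq , (λ v hv → Sum.map FP.suc-injective FP.suc-injective (u (suc v) (trans (sym (ra v)) hv)))))

  other-neighbour : ∀ {n} (H : BoolMatrix n) → IsFactor H → ∀ w z → H w z ≡ true → (∀ p → K₂Partner H w p → ⊥) →
    Σ (Fin n) λ x → x ≢ z × H w x ≡ true × (∀ v → H w v ≡ true → v ≡ z ⊎ v ≡ x)
  other-neighbour H (H-sym , H-irrefl , H-shape) w z hz nope with H-shape w
  ... | inj₁ iso = ⊥-elim (false≢true (trans (sym (iso z)) hz))
  ... | inj₂ (inj₁ (p , one)) = ⊥-elim (nope p one)
  ... | inj₂ (inj₂ (p , q , ne , hp , hq , u)) with u z hz
  ...   | inj₁ refl = q , (λ e → ne (sym e)) , hq , u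
  ...   | inj₂ refl = p , ne , hp , (λ v hv → Sum.swap (u v hv))

  -- Smoothing away vertex 0 of degree two with neighbours w = ŵ+1, w' = ŵ'+1:
  -- H' is H on 1..m with the edge ŵŵ' added; it is again a partial factor.
  module Smooth {m} (H : BoolMatrix (suc m)) (H-factor : IsFactor H) (ŵ ŵ' : Fin m) (two : TwoNeighbours H zero (suc ŵ) (suc ŵ')) where
    H-sym = proj₁ H-factor
    H-irrefl = proj₁ (proj₂ H-factor)
    H-shape = proj₂ (proj₂ H-factor)
    w : Fin (suc m)
    w = suc ŵ
    w' : Fin (suc m)
    w' = suc ŵ'
    ŵ≢ŵ′ : ŵ ≢ ŵ'
    ŵ≢ŵ′ e = proj₁ two (cong suc e)
    H0w : H zero w ≡ true
    H0w = proj₁ (proj₂ two)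
    H0w′ : H zero w' ≡ true
    H0w′ = proj₁ (proj₂ (proj₂ two))
    neighbours-of-0 : ∀ v → H zero v ≡ true → v ≡ w ⊎ v ≡ w'
    neighbours-of-0 = proj₂ (proj₂ (proj₂ two))
    Hw0 : H w zero ≡ true
    Hw0 = trans (H-sym w zero) H0w
    Hw′0 : H w' zero ≡ true
    Hw′0 = trans (H-sym w' zero) H0w′
    w-not-in-K₂ : ∀ p → K₂Partner H w p → ⊥
    w-not-in-K₂ p (hp , u1 , u2) with u1 zero Hw0
    ... | refl = ŵ≢ŵ′ (sym (FP.suc-injective (u2 w' H0w′)))
    w′-not-in-K₂ : ∀ p → K₂Partner H w' p → ⊥
    w′-not-in-K₂ p (hp , u1 , u2) with u1 zero Hw′0
    ... | refl = ŵ≢ŵ′ (FP.suc-injective (u2 w H0w))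
    w-other = other-neighbour H H-factor w zero Hw0 w-not-in-K₂
    w′-other = other-neighbour H H-factor w' zero Hw′0 w′-not-in-K₂
    x̂ : Fin m
    x̂ = punchOut (λ e → proj₁ (proj₂ w-other) (sym e))
    suc-x̂ : suc x̂ ≡ proj₁ w-other
    suc-x̂ = FP.punchIn-punchOut (λ e → proj₁ (proj₂ w-other) (sym e))
    ŷ : Fin m
    ŷ = punchOut (λ e → proj₁ (proj₂ w′-other) (sym e))
    suc-ŷ : suc ŷ ≡ proj₁ w′-other
    suc-ŷ = FP.punchIn-punchOut (λ e → proj₁ (proj₂ w′-other) (sym e))
    Hwx : H w (suc x̂) ≡ true
    Hwx = trans (cong (H w) suc-x̂) (proj₁ (proj₂ (proj₂ w-other)))
    Hwy : H w' (suc ŷ) ≡ true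
    Hwy = trans (cong (H w') suc-ŷ) (proj₁ (proj₂ (proj₂ w′-other)))
    w-neighbours : ∀ v → H w (suc v) ≡ true → v ≡ x̂
    w-neighbours v h with proj₂ (proj₂ (proj₂ w-other)) (suc v) h
    ... | inj₁ ()
    ... | inj₂ e = FP.suc-injective (trans e (sym suc-x̂))
    w′-neighbours : ∀ v → H w' (suc v) ≡ true → v ≡ ŷ
    w′-neighbours v h with proj₂ (proj₂ (proj₂ w′-other)) (suc v) h
    ... | inj₁ ()
    ... | inj₂ e = FP.suc-injective (trans e (sym suc-ŷ))

    newEdge : BoolMatrix m
    newEdge a b = (eqb a ŵ ∧ eqb b ŵ') ∨ (eqb a ŵ' ∧ eqb b ŵ)
    H' : BoolMatrix m
    H' a b = H (suc a) (suc b) ∨ newEdge a b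

    newEdge-ŵ : ∀ b → newEdge ŵ b ≡ eqb b ŵ'
    newEdge-ŵ b rewrite eqb-refl ŵ | eqb-false ŵ ŵ' ŵ≢ŵ′ = BP.∨-identityʳ (eqb b ŵ')
    newEdge-ŵ′ : ∀ b → newEdge ŵ' b ≡ eqb b ŵ
    newEdge-ŵ′ b rewrite eqb-refl ŵ' | eqb-false ŵ' ŵ (λ e → ŵ≢ŵ′ (sym e)) = refl
    newEdge-other : ∀ a → a ≢ ŵ → a ≢ ŵ' → ∀ b → newEdge a b ≡ false
    newEdge-other a n1 n2 b rewrite eqb-false a ŵ n1 | eqb-false a ŵ' n2 = refl
    newEdge-sym : ∀ a b → newEdge a b ≡ newEdge b a
    newEdge-sym a b = trans (BP.∨-comm (eqb a ŵ ∧ eqb b ŵ') (eqb a ŵ' ∧ eqb b ŵ)) (cong₂ _∨_ (BP.∧-comm (eqb a ŵ') (eqb b ŵ)) (BP.∧-comm (eqb a ŵ) (eqb b ŵ')))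

    H′-row-ŵ : ∀ b → H' ŵ b ≡ true → b ≡ x̂ ⊎ b ≡ ŵ'
    H′-row-ŵ b h with ∨-true _ _ h
    ... | inj₁ hb = inj₁ (w-neighbours b hb)
    ... | inj₂ eb = inj₂ (eqb-true b ŵ' (trans (sym (newEdge-ŵ b)) eb))
    H′-row-ŵ′ : ∀ b → H' ŵ' b ≡ true → b ≡ ŷ ⊎ b ≡ ŵ
    H′-row-ŵ′ b h with ∨-true _ _ h
    ... | inj₁ hb = inj₁ (w′-neighbours b hb)
    ... | inj₂ eb = inj₂ (eqb-true b ŵ (trans (sym (newEdge-ŵ′ b)) eb))
    H′-ŵŵ′ : H' ŵ ŵ' ≡ true
    H′-ŵŵ′ = trans (cong (H w w' ∨_) (trans (newEdge-ŵ ŵ') (eqb-refl ŵ'))) (BP.∨-zeroʳ (H w w'))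
    H⊆H′ : ∀ {a b} → H (suc a) (suc b) ≡ true → H' a b ≡ true
    H⊆H′ h = cong (_∨ _) h
    triangle⇒x̂≡ŵ′ : H w w' ≡ true → x̂ ≡ ŵ'
    triangle⇒x̂≡ŵ′ h = sym (w-neighbours ŵ' h)
    triangle⇒ŷ≡ŵ : H w' w ≡ true → ŷ ≡ ŵ
    triangle⇒ŷ≡ŵ h = sym (w′-neighbours ŵ h)
    x̂≡ŵ′⇒ŷ≡ŵ : x̂ ≡ ŵ' → ŷ ≡ ŵ
    x̂≡ŵ′⇒ŷ≡ŵ e = triangle⇒ŷ≡ŵ (trans (H-sym w' w) (subst (λ t → H w (suc t) ≡ true) e Hwx))
    ŷ≡ŵ⇒x̂≡ŵ′ : ŷ ≡ ŵ → x̂ ≡ ŵ'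
    ŷ≡ŵ⇒x̂≡ŵ′ e = triangle⇒x̂≡ŵ′ (trans (H-sym w w') (subst (λ t → H w' (suc t) ≡ true) e Hwy))

    newEdge-irrefl : ∀ a → newEdge a a ≡ false
    newEdge-irrefl a with ≡-or-≢ a ŵ
    ... | inj₁ refl = trans (newEdge-ŵ a) (eqb-false a ŵ' ŵ≢ŵ′)
    ... | inj₂ n1 with ≡-or-≢ a ŵ'
    ...   | inj₁ refl = trans (newEdge-ŵ′ a) (eqb-false a ŵ (λ e → ŵ≢ŵ′ (sym e)))
    ...   | inj₂ n2 = newEdge-other a n1 n2 a

    -- ŵ and ŵ' keep degree two in H', unless 0 w w' was a triangle, which
    -- becomes the K₂ {ŵ, ŵ'}; all other vertices keep their shape.
    H′-shape : ∀ a → LocalShape H' a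
    H′-shape a with ≡-or-≢ a ŵ
    ... | inj₁ refl with ≡-or-≢ x̂ ŵ'
    ...   | inj₁ ex = inj₂ (inj₁ (ŵ' , H′-ŵŵ′ , (λ v h → case1 (H′-row-ŵ v h)) , (λ v h → case2 (H′-row-ŵ′ v h))))
      where case1 : ∀ {v} → v ≡ x̂ ⊎ v ≡ ŵ' → v ≡ ŵ'
            case1 (inj₁ e) = trans e ex
            case1 (inj₂ e) = e
            case2 : ∀ {v} → v ≡ ŷ ⊎ v ≡ a → v ≡ a
            case2 (inj₁ e) = trans e (x̂≡ŵ′⇒ŷ≡ŵ ex)
            case2 (inj₂ e) = e
    ...   | inj₂ nx = inj₂ (inj₂ (x̂ , ŵ' , nx , H⊆H′ Hwx , H′-ŵŵ′ , H′-row-ŵ))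
    H′-shape a | inj₂ n1 with ≡-or-≢ a ŵ'
    ... | inj₁ refl with ≡-or-≢ ŷ ŵ
    ...   | inj₁ ey = inj₂ (inj₁ (ŵ , trans (cong₂ _∨_ (H-sym w' w) (newEdge-sym a ŵ)) H′-ŵŵ′ , (λ v h → case1 (H′-row-ŵ′ v h)) , (λ v h → case2 (H′-row-ŵ v h))))
      where case1 : ∀ {v} → v ≡ ŷ ⊎ v ≡ ŵ → v ≡ ŵ
            case1 (inj₁ e) = trans e ey
            case1 (inj₂ e) = e
            case2 : ∀ {v} → v ≡ x̂ ⊎ v ≡ a → v ≡ a
            case2 (inj₁ e) = trans e (ŷ≡ŵ⇒x̂≡ŵ′ ey)
            case2 (inj₂ e) = e
    ...   | inj₂ ny = inj₂ (inj₂ (ŷ , ŵ , ny , H⊆H′ Hwy , trans (cong₂ _∨_ (H-sym w' w) (newEdge-sym a ŵ)) H′-ŵŵ′ , H′-row-ŵ′))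
    H′-shape a | inj₂ n1 | inj₂ n2 = shape-restrict H H' a (λ b → trans (cong (H (suc a) (suc b) ∨_) (newEdge-other a n1 n2 b)) (BP.∨-identityʳ _)) h0 pr (H-shape (suc a))
      where
       h0 : H (suc a) zero ≡ false
       h0 with true-or-false (H zero (suc a))
       ... | inj₂ f = trans (H-sym (suc a) zero) f
       ... | inj₁ t with neighbours-of-0 (suc a) t
       ...   | inj₁ e = ⊥-elim (n1 (FP.suc-injective e))
       ...   | inj₂ e = ⊥-elim (n2 (FP.suc-injective e))
       pr : ∀ c → K₂Partner H (suc a) (suc c) → ∀ b → H' c b ≡ H (suc c) (suc b)
       pr c (hp , u1 , u2) b = trans (cong (H (suc c) (suc b) ∨_) (newEdge-other c nc1 nc2 b)) (BP.∨-identityʳ _)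
         where nc1 : c ≢ ŵ
               nc1 refl = FP.0≢1+n (u2 zero Hw0)
               nc2 : c ≢ ŵ'
               nc2 refl = FP.0≢1+n (u2 zero Hw′0)

    H′-factor : IsFactor H'
    H′-factor = (λ a b → cong₂ _∨_ (H-sym (suc a) (suc b)) (newEdge-sym a b)) , (λ a → trans (cong (_∨ newEdge a a) (H-irrefl (suc a))) (newEdge-irrefl a)) , H′-shape

    -- An orientation of H' walks the new edge as ŵ → ŵ'; inserting 0 in
    -- between gives an orientation of H.
    module Reinsert (out : Orientation H') (walks-ŵŵ' : walk out ŵ ≡ ŵ') where
      f' = walk out
      f'-inj = walk-injective out
      f'-step = walk-step out
      f'-covers = walk-covers out
      f = insert-after f' ŵ
      f0≡w' : f zero ≡ w'
      f0≡w' = cong suc walks-ŵŵ'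
      fw≡0 : f w ≡ zero
      fw≡0 = insert-after-x f' ŵ
      triangle-return : H w w' ≡ true → f' ŵ' ≡ ŵ
      triangle-return ht with f'-step ŵ'
      ... | inj₁ fx = ⊥-elim (ŵ≢ŵ′ (f'-inj ŵ ŵ' (trans walks-ŵŵ' (sym fx))))
      ... | inj₂ h with H′-row-ŵ′ (f' ŵ') h
      ...   | inj₂ r = r
      ...   | inj₁ r = trans r (x̂≡ŵ′⇒ŷ≡ŵ (triangle⇒x̂≡ŵ′ ht))
      -- Otherwise the walk cannot go back from ŵ' to ŵ: the edge ŵx̂ is walked.
      x̂≢ŵ' : H w w' ≡ false → x̂ ≢ ŵ'
      x̂≢ŵ' hf ex = false≢true (trans (sym hf) (subst (λ t → H w (suc t) ≡ true) ex Hwx))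
      no-return : H w w' ≡ false → f' ŵ' ≡ ŵ → ⊥
      no-return hf back with f'-covers ŵ x̂ (H⊆H′ Hwx)
      ... | inj₁ a = x̂≢ŵ' hf (trans (sym a) walks-ŵŵ')
      ... | inj₂ b = x̂≢ŵ' hf (f'-inj x̂ ŵ' (trans b (sym back)))
      step-in-H : ∀ i → i ≢ ŵ → H' i (f' i) ≡ true → H (suc i) (suc (f' i)) ≡ true
      step-in-H i ni h with ∨-true _ _ h
      ... | inj₁ hr = hr
      ... | inj₂ he with ≡-or-≢ i ŵ'
      ...   | inj₂ ni' = ⊥-elim (false≢true (trans (sym (newEdge-other i ni ni' (f' i))) he))
      ...   | inj₁ refl with true-or-false (H w w')
      ...     | inj₁ ht = trans (cong (λ t → H w' (suc t)) back) (trans (H-sym w' w) ht)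
        where back : f' ŵ' ≡ ŵ
              back = eqb-true _ _ (trans (sym (newEdge-ŵ′ (f' ŵ'))) he)
      ...     | inj₂ hf = ⊥-elim (no-return hf (eqb-true _ _ (trans (sym (newEdge-ŵ′ (f' ŵ'))) he)))
      step : ∀ u → f u ≡ u ⊎ H u (f u) ≡ true
      step zero = inj₂ (trans (cong (H zero) f0≡w') H0w′)
      step (suc i) with ≡-or-≢ i ŵ
      ... | inj₁ refl = inj₂ (trans (cong (H (suc i)) fw≡0) Hw0)
      ... | inj₂ ni with f'-step i
      ...   | inj₁ fx = inj₁ (trans (insert-after-other f' ŵ i ni) (cong suc fx))
      ...   | inj₂ h = inj₂ (trans (cong (H (suc i)) (insert-after-other f' ŵ i ni)) (step-in-H i ni h))
      -- An edge between ŵ' and ŵ walked by f' backwards comes from a triangle.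
      covers-ŵ : ∀ a b → H (suc a) (suc b) ≡ true → f' a ≡ b → a ≡ ŵ → f (suc b) ≡ suc a
      covers-ŵ a b h fa refl = trans (insert-after-other f' ŵ b b≢ŵ) (cong suc (trans (cong f' b≡ŵ') (triangle-return ht)))
        where b≡ŵ' : b ≡ ŵ'
              b≡ŵ' = trans (sym fa) walks-ŵŵ'
              b≢ŵ : b ≢ ŵ
              b≢ŵ eb = ŵ≢ŵ′ (trans (sym eb) b≡ŵ')
              ht : H w w' ≡ true
              ht = subst (λ t → H w (suc t) ≡ true) b≡ŵ' h
      covers : ∀ u v → H u v ≡ true → f u ≡ v ⊎ f v ≡ u
      covers zero v h with neighbours-of-0 v h
      ... | inj₁ refl = inj₂ fw≡0
      ... | inj₂ refl = inj₁ f0≡w'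
      covers (suc i) zero h with neighbours-of-0 (suc i) (trans (H-sym zero (suc i)) h)
      ... | inj₁ refl = inj₁ fw≡0
      ... | inj₂ refl = inj₂ f0≡w'
      covers (suc a) (suc b) h with f'-covers a b (H⊆H′ h)
      ... | inj₁ fa with ≡-or-≢ a ŵ
      ...   | inj₁ a≡ŵ = inj₂ (covers-ŵ a b h fa a≡ŵ)
      ...   | inj₂ na = inj₁ (trans (insert-after-other f' ŵ a na) (cong suc fa))
      covers (suc a) (suc b) h | inj₂ fb with ≡-or-≢ b ŵ
      ...   | inj₁ b≡ŵ = inj₁ (covers-ŵ b a (trans (H-sym (suc b) (suc a)) h) fb b≡ŵ)
      ...   | inj₂ nb = inj₂ (trans (insert-after-other f' ŵ b nb) (cong suc fb))
      result : Orientation H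
      result = mkOrientation f (insert-after-injective f' ŵ f'-inj) step covers

  Cover : ℕ → Set
  Cover m = ∀ (H : BoolMatrix m) → IsFactor H → Orientation H

  module Step {m} (cover-rest : Cover m) (H : BoolMatrix (suc m)) (g : IsFactor H) where
    H-sym = proj₁ g
    H-irrefl = proj₁ (proj₂ g)
    H-shape = proj₂ (proj₂ g)
    Hr : BoolMatrix m
    Hr a b = H (suc a) (suc b)

    isolated-zero : Isolated H zero → Orientation H
    isolated-zero iso = mkOrientation (lift f') (lift-injective f' (walk-injective out)) step covers
      where
       rest-factor : IsFactor Hr
       rest-factor = (λ a b → H-sym (suc a) (suc b)) , (λ a → H-irrefl (suc a)) ,
         (λ a → shape-restrict H Hr a (λ b → refl) (trans (H-sym (suc a) zero) (iso (suc a))) (λ c _ b → refl) (H-shape (suc a)))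
       out = cover-rest Hr rest-factor
       f' = walk out
       step : ∀ u → lift f' u ≡ u ⊎ H u (lift f' u) ≡ true
       step zero = inj₁ refl
       step (suc i) with walk-step out i
       ... | inj₁ e = inj₁ (cong suc e)
       ... | inj₂ h = inj₂ h
       covers : ∀ u v → H u v ≡ true → lift f' u ≡ v ⊎ lift f' v ≡ u
       covers zero v h = ⊥-elim (false≢true (trans (sym (iso v)) h))
       covers (suc i) zero h = ⊥-elim (false≢true (trans (sym (trans (H-sym (suc i) zero) (iso (suc i)))) h))
       covers (suc a) (suc b) h with walk-covers out a b h
       ... | inj₁ e = inj₁ (cong suc e)
       ... | inj₂ e = inj₂ (cong suc e)

    module K₂-zero (p : Fin m) (partner : K₂Partner H zero (suc p)) where
      hp = proj₁ partner
      only-p = proj₁ (proj₂ partner)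
      only-0 = proj₂ (proj₂ partner)
      p-isolated : ∀ b → Hr p b ≡ false
      p-isolated b with true-or-false (Hr p b)
      ... | inj₁ t = ⊥-elim (FP.0≢1+n (sym (only-0 (suc b) t)))
      ... | inj₂ f = f
      not-adjacent-0 : ∀ a → a ≢ p → H (suc a) zero ≡ false
      not-adjacent-0 a ne with true-or-false (H zero (suc a))
      ... | inj₁ t = ⊥-elim (ne (FP.suc-injective (only-p (suc a) t)))
      ... | inj₂ f = trans (H-sym (suc a) zero) f
      rest-shape : ∀ a → LocalShape Hr a
      rest-shape a with ≡-or-≢ a p
      ... | inj₁ refl = inj₁ p-isolated
      ... | inj₂ ne = shape-restrict H Hr a (λ b → refl) (not-adjacent-0 a ne) (λ c _ b → refl) (H-shape (suc a))
      out = cover-rest Hr ((λ a b → H-sym (suc a) (suc b)) , (λ a → H-irrefl (suc a)) , rest-shape)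
      f' = walk out
      f'p≡p : f' p ≡ p
      f'p≡p with walk-step out p
      ... | inj₁ e = e
      ... | inj₂ h = ⊥-elim (false≢true (trans (sym (p-isolated (f' p))) h))
      f0≡p : insert-after f' p zero ≡ suc p
      f0≡p = cong suc f'p≡p
      source≢p : ∀ {a b} → H (suc a) (suc b) ≡ true → a ≢ p
      source≢p {a} {b} h refl = false≢true (trans (sym (p-isolated b)) h)
      target≢p : ∀ {a b} → H (suc a) (suc b) ≡ true → b ≢ p
      target≢p {a} {b} h refl = false≢true (trans (sym (p-isolated a)) (trans (H-sym (suc b) (suc a)) h))
      step : ∀ u → insert-after f' p u ≡ u ⊎ H u (insert-after f' p u) ≡ true
      step zero = inj₂ (trans (cong (H zero) f0≡p) hp)
      step (suc i) with ≡-or-≢ i p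
      ... | inj₁ refl = inj₂ (trans (cong (H (suc i)) (insert-after-x f' i)) (trans (H-sym (suc i) zero) hp))
      ... | inj₂ ne with walk-step out i
      ...   | inj₁ e = inj₁ (trans (insert-after-other f' p i ne) (cong suc e))
      ...   | inj₂ h = inj₂ (trans (cong (H (suc i)) (insert-after-other f' p i ne)) h)
      covers : ∀ u v → H u v ≡ true → insert-after f' p u ≡ v ⊎ insert-after f' p v ≡ u
      covers zero v h = inj₁ (trans f0≡p (sym (only-p v h)))
      covers (suc i) zero h with only-p (suc i) (trans (H-sym zero (suc i)) h)
      ... | refl = inj₁ (insert-after-x f' p)
      covers (suc a) (suc b) h with walk-covers out a b h
      ... | inj₁ e = inj₁ (trans (insert-after-other f' p a (source≢p h)) (cong suc e))
      ... | inj₂ e = inj₂ (trans (insert-after-other f' p b (target≢p h)) (cong suc e))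
      result : Orientation H
      result = mkOrientation (insert-after f' p) (insert-after-injective f' p (walk-injective out)) step covers

    -- The recursion walks the new edge ŵŵ' in one of its two directions.
    degree-two-zero : ∀ ŵ ŵ' → TwoNeighbours H zero (suc ŵ) (suc ŵ') → Orientation H
    degree-two-zero ŵ ŵ' two = reinsert (walk-covers out ŵ ŵ' S.H′-ŵŵ′)
      where
       module S = Smooth H g ŵ ŵ' two
       two' : TwoNeighbours H zero (suc ŵ') (suc ŵ)
       two' = (λ e → proj₁ two (sym e)) , proj₁ (proj₂ (proj₂ two)) , proj₁ (proj₂ two) , (λ v h → Sum.swap (proj₂ (proj₂ (proj₂ two)) v h))
       module S' = Smooth H g ŵ' ŵ two'
       out = cover-rest S.H' S.H′-factor
       same-H' : ∀ a b → S.H' a b ≡ S'.H' a b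
       same-H' a b = cong (H (suc a) (suc b) ∨_) (BP.∨-comm (eqb a ŵ ∧ eqb b ŵ') (eqb a ŵ' ∧ eqb b ŵ))
       reinsert : walk out ŵ ≡ ŵ' ⊎ walk out ŵ' ≡ ŵ → Orientation H
       reinsert (inj₁ e) = S.Reinsert.result out e
       reinsert (inj₂ e) = S'.Reinsert.result (orientation-cong same-H' out) e

    result : Orientation H
    result with H-shape zero
    ... | inj₁ iso = isolated-zero iso
    ... | inj₂ (inj₁ (zero , hp , _)) = ⊥-elim (false≢true (trans (sym (H-irrefl zero)) hp))
    ... | inj₂ (inj₁ (suc p , partner)) = K₂-zero.result p partner
    ... | inj₂ (inj₂ (zero , q , ne , hp , _)) = ⊥-elim (false≢true (trans (sym (H-irrefl zero)) hp))
    ... | inj₂ (inj₂ (suc ŵ , zero , ne , _ , hq , _)) = ⊥-elim (false≢true (trans (sym (H-irrefl zero)) hq))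
    ... | inj₂ (inj₂ (suc ŵ , suc ŵ' , two)) = degree-two-zero ŵ ŵ' two

  cover : ∀ m → Cover m
  cover zero H g = mkOrientation (λ ()) (λ ()) (λ ()) (λ ())
  cover (suc m) = Step.result (cover m)

  -- The {1,2}-factor H of G is a partial factor without isolated vertices,
  -- so its orientation moves every vertex to a G-neighbour.
  edge-permutation-of-factor : ∀ {n} (G : Graph n) → OneTwoFactor G → EdgePermutation G
  edge-permutation-of-factor {n} G F = record { perm = walk out ; injective = walk-injective out ; along-edge = along-edge }
    where
     open OneTwoFactor F using (H; Hsym; H⊆G; deg12; K₂comp)
     H-irrefl : ∀ u → H u u ≡ false
     H-irrefl u with true-or-false (H u u)
     ... | inj₁ t = ⊥-elim (false≢true (trans (sym (irrefl G u)) (H⊆G u u t)))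
     ... | inj₂ x = x
     degree-1 : ∀ u → deg H u ≡ 1 → Σ (Fin n) λ p → H u p ≡ true × (∀ v → H u v ≡ true → v ≡ p)
     degree-1 u d1 = count≡1⇒ n (H u) (trans (sym (deg≡count H u)) d1)
     shape : ∀ u → LocalShape H u
     shape u with deg12 u
     ... | inj₁ d1 = inj₂ (inj₁ (p , hp , only-p , only-u))
       where open Σ (degree-1 u d1) renaming (proj₁ to p; proj₂ to rest)
             hp = proj₁ rest
             only-p = proj₂ rest
             only-u : ∀ v → H p v ≡ true → v ≡ u
             only-u v hv = trans (proj₂ (proj₂ r) v hv) (sym (proj₂ (proj₂ r) u (trans (Hsym p u) hp)))
               where r = degree-1 p (K₂comp u p hp d1)
     ... | inj₂ d2 = inj₂ (inj₂ (count≡2⇒ n (H u) (trans (sym (deg≡count H u)) d2)))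
     some-neighbour : ∀ u → Σ (Fin n) λ p → H u p ≡ true
     some-neighbour u with deg12 u
     ... | inj₁ d1 = proj₁ (degree-1 u d1) , proj₁ (proj₂ (degree-1 u d1))
     ... | inj₂ d2 = let r = count≡2⇒ n (H u) (trans (sym (deg≡count H u)) d2) in proj₁ r , proj₁ (proj₂ (proj₂ (proj₂ r)))
     out = cover n H (Hsym , H-irrefl , shape)
     f = walk out
     -- No vertex is fixed: its edge to a neighbour must be walked.
     moves : ∀ u → f u ≢ u
     moves u fx with walk-covers out u (proj₁ (some-neighbour u)) (proj₂ (some-neighbour u))
     ... | inj₁ e = false≢true (trans (sym (H-irrefl u)) (subst (λ t → H u t ≡ true) (trans (sym e) fx) (proj₂ (some-neighbour u))))
     ... | inj₂ e = false≢true (trans (sym (H-irrefl u))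
                     (subst (λ t → H u t ≡ true) (walk-injective out _ _ (trans e (sym fx))) (proj₂ (some-neighbour u))))
     along-edge : ∀ i → adj G i (f i) ≡ true
     along-edge i with walk-step out i
     ... | inj₁ fx = ⊥-elim (moves i fx)
     ... | inj₂ h = H⊆G i (f i) h


theorem2p1 : ∀ (n : ℕ) (G : Graph n) →
    (Σ (SignOf G) (λ σ → FullRank n (signedAdj G σ))) ⇔ OneTwoFactor G
theorem2p1 n G = mk⇔
  (λ full → FactorFromPermutation.factor G (PermutationFromFullRank.edge-permutation n G full))
  (λ F → NonsingularSigning.nonsingular G (PermutationFromFactor.edge-permutation-of-factor G F))
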